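{- The category $\mathbb{T}$ (described in the context) has finite coproducts, where the initial object is the empty list and the coproduct $X+Y$ of objects $X$ and $Y$ is the concatenation of the lists $X$ and $Y$. Moreover, $\mathbb{T}$ has a uniform trace with respect to these coproducts.
   Context: Target types: $A,B ::= \alpha \mid \mathtt{unit} \mid \mathtt{nat} \mid A\times B \mid A+B \mid \mu\alpha.A$, with the usual target expressions ($<>$, numerals, $+$, $\mathtt{iszero}$, pairs and $\mathtt{let}$-pattern matching, $\mathtt{inl}$/$\mathtt{inr}$/$\mathtt{case}$, $\mathtt{fold}$/$\mathtt{unfold}$), standard simple typing, and standard call-by-value reduction $\longrightarrow$ to values; every closed well-typed expression reduces to a unique value. Fix an infinite set $\mathcal{L}$ of labels. A function definition for $f\in\mathcal{L}$ is $f(x)=g(e)$ or $f(x)=\mathtt{case}\ e\ \mathtt{of}\ \mathtt{inl}(y)\Rightarrow g(e_1)\mid \mathtt{inr}(z)\Rightarrow h(e_2)$. A target program $P=(i,D,o)$ has a set $D$ of definitions (at most one per label, none for labels in $o$), a list $i$ of pairwise distinct entry labels and a list $o$ of pairwise distinct exit labels; it is well typed when each label gets an argument type making all definitions type-check, and then $P\colon (A_1\dots A_n)\to(B_1\dots B_m)$ lists the argument types of the entry and exit labels. $f(v)\longrightarrow_P g(w)$ means that executing the definition of $f$ on value $v$ (evaluating the expressions, choosing the branch in the case form) jumps to $g$ with value $w$; a call-trace is a sequence $f_1(v_1)\dots f_n(v_n)$ with $f_k(v_k)\longrightarrow_P f_{k+1}(v_{k+1})$. Two programs of the same type with entries $f_1..f_n$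 / $g_1..g_n$ and exits $h_1..h_m$ / $k_1..k_m$ are equal if for all $v,w,i,j$: $P$ has a call-trace $f_i(v)\dots h_j(w)$ iff $Q$ has a call-trace $g_i(v)\dots k_j(w)$. $\mathbb{T}$ is the category whose objects are finite lists of target types and whose morphisms $X\to Y$ are equivalence classes of well-typed programs $X\to Y$ under program equality; the identity on $A_1\dots A_n$ is $(f_1\dots f_n,\emptyset,f_1\dots f_n)$, and the composite of $P=(i,D_P,m)$ and $Q=(m,D_Q,o)$ (after renaming so that exits of $P$ are the entries of $Q$ and other labels are disjoint) is $(i,D_P\cup D_Q,o)$. A uniform trace with respect to coproducts is in the sense of Hasegawa (a family of operations $\mathrm{Tr}^U\colon \mathbb{T}(X+U,Y+U)\to\mathbb{T}(X,Y)$ satisfying the trace axioms and uniformity). -}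

module Defs where

open import Data.Nat as ℕ using (ℕ; zero; suc; _+_; _*_)
open import Data.Nat.Properties as ℕP using ()
open import Data.Fin as Fin using (Fin; toℕ)
open import Data.Fin.Properties as FinP using (any?)
open import Data.List using (List; []; _∷_; _++_; length; lookup; map)
open import Data.List.Relation.Unary.All as All using (All; []; _∷_)
open import Data.List.Relation.Unary.Unique.Propositional using (Unique)
open import Data.List.Relation.Unary.Unique.Propositional.Properties as UniqueP using ()
open import Data.List.Membership.Propositional using (_∈_; _∉_)
open import Data.List.Membership.Propositional.Properties using (∈-++⁻; ∈-map⁻)
open import Data.List.Properties using (map-++; map-∘)
open import Data.Product using (Σ; ∃; _×_; _,_; proj₁; proj₂)
open import Data.Product.Properties using (,-injectiveˡ; ,-injectiveʳ)
open import Data.Product.Relation.Binary.Pointwise.NonDependent using (≡×≡⇒≡)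
open import Data.Sum using (inj₁; inj₂)
open import Data.Empty using (⊥; ⊥-elim)
open import Relation.Nullary using (Dec; yes; no; ¬_)
open import Relation.Nullary.Decidable using (map′; _×-dec_)
open import Relation.Binary.PropositionalEquality
  using (_≡_; refl; sym; trans; cong; subst)
open import Relation.Binary.Definitions using (DecidableEquality)
open import Relation.Binary.Construct.Closure.ReflexiveTransitive using (Star)
open import Function.Bundles using (_⇔_)
open import Function.Definitions using (Injective)

-- Target types  A ::= α | unit | nat | A × B | A + B | μα.A
-- (de Bruijn: Ty n = types with n free type variables)

infixr 7 _`×_
infixr 6 _`+_

data Ty (n : ℕ) : Set where
  `var  : Fin n → Ty n
  `unit : Ty n
  `nat  : Ty n
  _`×_  : Ty n → Ty n → Ty n
  _`+_  : Ty n → Ty n → Ty n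
  `μ    : Ty (suc n) → Ty n

Ty₀ : Set
Ty₀ = Ty 0

extR : ∀ {n m} → (Fin n → Fin m) → Fin (suc n) → Fin (suc m)
extR ρ Fin.zero    = Fin.zero
extR ρ (Fin.suc i) = Fin.suc (ρ i)

renTy : ∀ {n m} → (Fin n → Fin m) → Ty n → Ty m
renTy ρ (`var i)  = `var (ρ i)
renTy ρ `unit     = `unit
renTy ρ `nat      = `nat
renTy ρ (A `× B)  = renTy ρ A `× renTy ρ B
renTy ρ (A `+ B)  = renTy ρ A `+ renTy ρ B
renTy ρ (`μ A)    = `μ (renTy (extR ρ) A)

extS : ∀ {n m} → (Fin n → Ty m) → Fin (suc n) → Ty (suc m)
extS σ Fin.zero    = `var Fin.zero
extS σ (Fin.suc i) = renTy Fin.suc (σ i)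

subTy : ∀ {n m} → (Fin n → Ty m) → Ty n → Ty m
subTy σ (`var i)  = σ i
subTy σ `unit     = `unit
subTy σ `nat      = `nat
subTy σ (A `× B)  = subTy σ A `× subTy σ B
subTy σ (A `+ B)  = subTy σ A `+ subTy σ B
subTy σ (`μ A)    = `μ (subTy (extS σ) A)

_[_]ᵀ : ∀ {n} → Ty (suc n) → Ty n → Ty n
A [ B ]ᵀ = subTy σ A
  where
  σ : Fin (suc _) → Ty _
  σ Fin.zero    = B
  σ (Fin.suc i) = `var i

_≟Ty_ : ∀ {n} → DecidableEquality (Ty n)
(`var a1) ≟Ty (`var b1) = map′ (cong `var) (λ { refl → refl }) (a1 Fin.≟ b1)
(`var a1) ≟Ty `unit = no (λ ())
(`var a1) ≟Ty `nat = no (λ ())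
(`var a1) ≟Ty (b1 `× b2) = no (λ ())
(`var a1) ≟Ty (b1 `+ b2) = no (λ ())
(`var a1) ≟Ty (`μ b1) = no (λ ())
`unit ≟Ty (`var b1) = no (λ ())
`unit ≟Ty `unit = yes refl
`unit ≟Ty `nat = no (λ ())
`unit ≟Ty (b1 `× b2) = no (λ ())
`unit ≟Ty (b1 `+ b2) = no (λ ())
`unit ≟Ty (`μ b1) = no (λ ())
`nat ≟Ty (`var b1) = no (λ ())
`nat ≟Ty `unit = no (λ ())
`nat ≟Ty `nat = yes refl
`nat ≟Ty (b1 `× b2) = no (λ ())
`nat ≟Ty (b1 `+ b2) = no (λ ())
`nat ≟Ty (`μ b1) = no (λ ())
(a1 `× a2) ≟Ty (`var b1) = no (λ ())
(a1 `× a2) ≟Ty `unit = no (λ ())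
(a1 `× a2) ≟Ty `nat = no (λ ())
(a1 `× a2) ≟Ty (b1 `× b2) = map′ (λ { (refl , refl) → refl }) (λ { refl → refl , refl }) (a1 ≟Ty b1 ×-dec a2 ≟Ty b2)
(a1 `× a2) ≟Ty (b1 `+ b2) = no (λ ())
(a1 `× a2) ≟Ty (`μ b1) = no (λ ())
(a1 `+ a2) ≟Ty (`var b1) = no (λ ())
(a1 `+ a2) ≟Ty `unit = no (λ ())
(a1 `+ a2) ≟Ty `nat = no (λ ())
(a1 `+ a2) ≟Ty (b1 `× b2) = no (λ ())
(a1 `+ a2) ≟Ty (b1 `+ b2) = map′ (λ { (refl , refl) → refl }) (λ { refl → refl , refl }) (a1 ≟Ty b1 ×-dec a2 ≟Ty b2)
(a1 `+ a2) ≟Ty (`μ b1) = no (λ ())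
(`μ a1) ≟Ty (`var b1) = no (λ ())
(`μ a1) ≟Ty `unit = no (λ ())
(`μ a1) ≟Ty `nat = no (λ ())
(`μ a1) ≟Ty (b1 `× b2) = no (λ ())
(`μ a1) ≟Ty (b1 `+ b2) = no (λ ())
(`μ a1) ≟Ty (`μ b1) = map′ (cong `μ) (λ { refl → refl }) (a1 ≟Ty b1)

data Val : Ty₀ → Set where
  ⟨⟩   : Val `unit
  num  : ℕ → Val `nat
  pair : ∀ {A B} → Val A → Val B → Val (A `× B)
  inl  : ∀ {A B} → Val A → Val (A `+ B)
  inr  : ∀ {A B} → Val B → Val (A `+ B)
  fold : ∀ {A : Ty 1} → Val (A [ `μ A ]ᵀ) → Val (`μ A)

-- Well-typed target expressions  Γ ⊢ e : A  (intrinsically typed;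
-- contexts are lists of closed types, variables are de Bruijn positions)

Ctx : Set
Ctx = List Ty₀

data Exp (Γ : Ctx) : Ty₀ → Set where
  var      : ∀ {A} → A ∈ Γ → Exp Γ A
  ⟨⟩       : Exp Γ `unit
  num      : ℕ → Exp Γ `nat
  _⊕_      : Exp Γ `nat → Exp Γ `nat → Exp Γ `nat
  iszero   : Exp Γ `nat → Exp Γ (`unit `+ `unit)
  pair     : ∀ {A B} → Exp Γ A → Exp Γ B → Exp Γ (A `× B)
  letpair  : ∀ {A B C} → Exp Γ (A `× B) → Exp (A ∷ B ∷ Γ) C → Exp Γ C
  inl      : ∀ {A B} → Exp Γ A → Exp Γ (A `+ B)
  inr      : ∀ {A B} → Exp Γ B → Exp Γ (A `+ B)
  case     : ∀ {A B C} → Exp Γ (A `+ B) → Exp (A ∷ Γ) C → Exp (B ∷ Γ) C → Exp Γ C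
  fold     : ∀ {A : Ty 1} → Exp Γ (A [ `μ A ]ᵀ) → Exp Γ (`μ A)
  unfold   : ∀ {A : Ty 1} → Exp Γ (`μ A) → Exp Γ (A [ `μ A ]ᵀ)

Env : Ctx → Set
Env Γ = All Val Γ

private
  addV : Val `nat → Val `nat → Val `nat
  addV (num m) (num n) = num (m + n)

  iszeroV : Val `nat → Val (`unit `+ `unit)
  iszeroV (num zero)    = inl ⟨⟩
  iszeroV (num (suc _)) = inr ⟨⟩

  unfoldV : ∀ {A : Ty 1} → Val (`μ A) → Val (A [ `μ A ]ᵀ)
  unfoldV (fold v) = v

eval : ∀ {Γ A} → Exp Γ A → Env Γ → Val A
eval (var x) ρ          = All.lookup ρ x
eval ⟨⟩ ρ               = ⟨⟩
eval (num n) ρ          = num n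
eval (e₁ ⊕ e₂) ρ        = addV (eval e₁ ρ) (eval e₂ ρ)
eval (iszero e) ρ       = iszeroV (eval e ρ)
eval (pair e₁ e₂) ρ     = pair (eval e₁ ρ) (eval e₂ ρ)
eval (letpair e e') ρ   with eval e ρ
... | pair v w          = eval e' (v ∷ w ∷ ρ)
eval (inl e) ρ          = inl (eval e ρ)
eval (inr e) ρ          = inr (eval e ρ)
eval (case e e₁ e₂) ρ   with eval e ρ
... | inl v             = eval e₁ (v ∷ ρ)
... | inr w             = eval e₂ (w ∷ ρ)
eval (fold e) ρ         = fold (eval e ρ)
eval (unfold e) ρ       = unfoldV (eval e ρ)

-- Labels.  The infinite label set 𝓛 is taken to be Ty₀ × ℕ: a label
-- carries its argument type (so every label has an argument type and
-- definitions are well typed by construction).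

Label : Set
Label = Ty₀ × ℕ

argTy : Label → Ty₀
argTy = proj₁

_≟L_ : DecidableEquality Label
(A , m) ≟L (B , n) = map′ (λ { (refl , refl) → refl }) (λ { refl → refl , refl }) (A ≟Ty B ×-dec m ℕ.≟ n)

-- A function definition body for a label with argument type A:
--   f(x) = g(e)
--   f(x) = case e of inl(y) ⇒ g(e₁) | inr(z) ⇒ h(e₂)
data Body (A : Ty₀) : Set where
  jump : (g : Label) → Exp (A ∷ []) (argTy g) → Body A
  case : ∀ {B C} → Exp (A ∷ []) (B `+ C)
       → (g : Label) → Exp (B ∷ A ∷ []) (argTy g)
       → (h : Label) → Exp (C ∷ A ∷ []) (argTy h)
       → Body A

Def : Set
Def = Σ Label (λ f → Body (argTy f))

Call : Set
Call = Σ Label (λ f → Val (argTy f))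

run : ∀ {A} → Body A → Val A → Call
run (jump g e) v = g , eval e (v ∷ [])
run (case e g e₁ h e₂) v with eval e (v ∷ [])
... | inl y = g , eval e₁ (y ∷ v ∷ [])
... | inr z = h , eval e₂ (z ∷ v ∷ [])

record Prog (X Y : List Ty₀) : Set where
  field
    ent  : Fin (length X) → ℕ
    ext  : Fin (length Y) → ℕ
    defs : List Def

  entL : Fin (length X) → Label
  entL k = lookup X k , ent k

  extL : Fin (length Y) → Label
  extL k = lookup Y k , ext k

  defined : List Label
  defined = map proj₁ defs

  field
    ent-distinct  : Injective _≡_ _≡_ entL
    ext-distinct  : Injective _≡_ _≡_ extL
    defs-unique   : Unique defined
    ext-undefined : ∀ k → extL k ∉ defined

open Prog public

Step : ∀ {X Y} → Prog X Y → Call → Call → Set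
Step P (f , v) c = Σ (Body (argTy f)) λ b → ((f , b) ∈ defs P) × (run b v ≡ c)

Trace : ∀ {X Y} → Prog X Y → Call → Call → Set
Trace P = Star (Step P)

infix 4 _≈_
_≈_ : ∀ {X Y} → Prog X Y → Prog X Y → Set
_≈_ {X} {Y} P Q =
  ∀ (i : Fin (length X)) (v : Val (lookup X i))
    (j : Fin (length Y)) (w : Val (lookup Y j)) →
  Trace P (entL P i , v) (extL P j , w) ⇔ Trace Q (entL Q i , v) (extL Q j , w)

-- The category 𝕋: objects List Ty₀, morphisms Prog X Y modulo _≈_.

idP : ∀ {X} → Prog X X
idP = record
  { ent = toℕ ; ext = toℕ ; defs = []
  ; ent-distinct = λ eq → FinP.toℕ-injective (,-injectiveʳ eq)
  ; ext-distinct = λ eq → FinP.toℕ-injective (,-injectiveʳ eq)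
  ; defs-unique = Data.List.Relation.Unary.AllPairs.[]
  ; ext-undefined = λ k () }
  where import Data.List.Relation.Unary.AllPairs

renL : (Ty₀ → ℕ → ℕ) → Label → Label
renL ρ l = proj₁ l , ρ (proj₁ l) (proj₂ l)

renBody : ∀ {A} → (Ty₀ → ℕ → ℕ) → Body A → Body A
renBody ρ (jump g e)           = jump (renL ρ g) e
renBody ρ (case e g e₁ h e₂)   = case e (renL ρ g) e₁ (renL ρ h) e₂

renDef : (Ty₀ → ℕ → ℕ) → Def → Def
renDef ρ d = renL ρ (proj₁ d) , renBody ρ (proj₂ d)

dbl : ℕ → ℕ
dbl zero    = zero
dbl (suc n) = suc (suc (dbl n))

private
  dbl-inj : ∀ {m n} → dbl m ≡ dbl n → m ≡ n
  dbl-inj {zero}  {zero}  eq = refl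
  dbl-inj {suc m} {suc n} eq = cong suc (dbl-inj (ℕP.suc-injective (ℕP.suc-injective eq)))
  dbl-inj {zero}  {suc n} ()
  dbl-inj {suc m} {zero}  ()

  even≢odd : ∀ m n → dbl m ≡ suc (dbl n) → ⊥
  even≢odd zero    n       ()
  even≢odd (suc m) zero    ()
  even≢odd (suc m) (suc n) eq = even≢odd m n (ℕP.suc-injective (ℕP.suc-injective eq))

  defined-ren : ∀ ρ (ds : List Def) → map proj₁ (map (renDef ρ) ds) ≡ map (renL ρ) (map proj₁ ds)
  defined-ren ρ []       = refl
  defined-ren ρ (d ∷ ds) = cong (_ ∷_) (defined-ren ρ ds)

-- composite  P ⨾ Q  (first P, then Q): the labels of P are renamed to
-- even numbers, the labels of Q to odd numbers, except that the k-th entry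
-- label of Q is renamed to the (renamed) k-th exit label of P; then the
-- definitions are joined:  (i, D_P ∪ D_Q, o).
module Composite {X Y Z : List Ty₀} (P : Prog X Y) (Q : Prog Y Z) where

  isEntQ : ∀ A n → Dec (∃ λ k → entL Q k ≡ (A , n))
  isEntQ A n = any? (λ k → entL Q k ≟L (A , n))

  pick : ∀ {A n} → Dec (∃ λ k → entL Q k ≡ (A , n)) → ℕ
  pick (yes (k , _)) = dbl (ext P k)
  pick {n = n} (no _) = suc (dbl n)

  ρP : Ty₀ → ℕ → ℕ
  ρP A n = dbl n

  ρQ : Ty₀ → ℕ → ℕ
  ρQ A n = pick (isEntQ A n)

  data View′ (A : Ty₀) (n : ℕ) (r : ℕ) : Set where
    hit  : ∀ k → entL Q k ≡ (A , n) → r ≡ dbl (ext P k) → View′ A n r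
    miss : r ≡ suc (dbl n) → View′ A n r

  go : ∀ {A n} (d : Dec (∃ λ k → entL Q k ≡ (A , n))) → View′ A n (pick d)
  go (yes (k , eq)) = hit k eq refl
  go (no _)         = miss refl

  view : ∀ A n → View′ A n (ρQ A n)
  view A n = go (isEntQ A n)

  renQ-inj : ∀ {l l'} → renL ρQ l ≡ renL ρQ l' → l ≡ l'
  renQ-inj {A , n} {A' , n'} eq with ,-injectiveˡ eq
  ... | refl with view A n | view A n' | ,-injectiveʳ eq
  ... | hit k e r | hit k' e' r' | eq₂ =
        trans (sym e) (trans (cong (entL Q) (ext-distinct P (≡×≡⇒≡ (trans (,-injectiveˡ e) (sym (,-injectiveˡ e')) , dbl-inj (trans (sym r) (trans eq₂ r')))))) e')
  ... | hit k e r | miss r' | eq₂ = ⊥-elim (even≢odd _ _ (trans (sym r) (trans eq₂ r')))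
  ... | miss r | hit k e r' | eq₂ = ⊥-elim (even≢odd _ _ (trans (sym r') (trans (sym eq₂) r)))
  ... | miss r | miss r' | eq₂ = cong (A ,_) (dbl-inj (ℕP.suc-injective (trans (sym r) (trans eq₂ r'))))

  renP-inj : ∀ {l l'} → renL ρP l ≡ renL ρP l' → l ≡ l'
  renP-inj {A , n} {A' , n'} eq = ≡×≡⇒≡ (,-injectiveˡ eq , dbl-inj (,-injectiveʳ eq))

  P-vs-Q : ∀ {l l'} → l ∈ defined P → renL ρP l ≡ renL ρQ l' → ⊥
  P-vs-Q {A , n} {A' , n'} l∈ eq with ,-injectiveˡ eq
  ... | refl with view A n' | ,-injectiveʳ eq
  ... | hit k e r | eq₂ =
        ext-undefined P k (subst (_∈ defined P) (≡×≡⇒≡ (sym (,-injectiveˡ e) , dbl-inj (trans eq₂ r))) l∈)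
  ... | miss r | eq₂ = even≢odd _ _ (trans eq₂ r)

  definedPQ : List Label
  definedPQ = map (renL ρP) (defined P) ++ map (renL ρQ) (defined Q)

  allDefs : List Def
  allDefs = map (renDef ρP) (defs P) ++ map (renDef ρQ) (defs Q)

  allDefined : map proj₁ allDefs ≡ definedPQ
  allDefined = trans (map-++ proj₁ (map (renDef ρP) (defs P)) (map (renDef ρQ) (defs Q)))
                     (Relation.Binary.PropositionalEquality.cong₂ _++_ (defined-ren ρP (defs P)) (defined-ren ρQ (defs Q)))
    where import Relation.Binary.PropositionalEquality

  uniquePQ : Unique definedPQ
  uniquePQ = UniqueP.++⁺ (UniqueP.map⁺ renP-inj (defs-unique P))
                         (UniqueP.map⁺ renQ-inj (defs-unique Q))
                         disj
    where
    disj : ∀ {v} → ¬ (v ∈ map (renL ρP) (defined P) × v ∈ map (renL ρQ) (defined Q))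
    disj (v∈₁ , v∈₂) with ∈-map⁻ (renL ρP) v∈₁ | ∈-map⁻ (renL ρQ) v∈₂
    ... | (l , l∈ , refl) | (l' , _ , eq) = P-vs-Q l∈ eq

  extUndef : ∀ k → renL ρQ (extL Q k) ∉ definedPQ
  extUndef k e∈ with ∈-++⁻ (map (renL ρP) (defined P)) e∈
  ... | inj₁ e∈₁ with ∈-map⁻ (renL ρP) e∈₁
  ...   | (l , l∈ , eq) = P-vs-Q l∈ (sym eq)
  extUndef k e∈ | inj₂ e∈₂ with ∈-map⁻ (renL ρQ) e∈₂
  ...   | (l , l∈ , eq) = ext-undefined Q k (subst (_∈ defined Q) (sym (renQ-inj eq)) l∈)

  composite : Prog X Z
  composite = record
    { ent  = λ i → dbl (ent P i)
    ; ext  = λ j → ρQ (lookup Z j) (ext Q j)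
    ; defs = allDefs
    ; ent-distinct  = λ eq → ent-distinct P (renP-inj eq)
    ; ext-distinct  = λ eq → ext-distinct Q (renQ-inj eq)
    ; defs-unique   = subst Unique (sym allDefined) uniquePQ
    ; ext-undefined = λ k e∈ → extUndef k (subst (renL ρQ (extL Q k) ∈_) allDefined e∈)
    }

infixl 5 _⨾_
_⨾_ : ∀ {X Y Z} → Prog X Y → Prog Y Z → Prog X Z
P ⨾ Q = Composite.composite P Q

infixr 9 _∘_
_∘_ : ∀ {X Y Z} → Prog Y Z → Prog X Y → Prog X Z
g ∘ f = f ⨾ g

-- The evident coproduct injections for concatenation of lists:
--   inl : X → X ++ Y  is  (f₁…fₙ, ∅, f₁…fₙ g₁…gₘ)
--   inr : Y → X ++ Y  is  (g₁…gₘ, ∅, f₁…fₙ g₁…gₘ)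
-- (the k-th position of X ++ Y carries the label (type, k)).

inlP : ∀ {X Y} → Prog X (X ++ Y)
inlP = record
  { ent = toℕ ; ext = toℕ ; defs = []
  ; ent-distinct = λ eq → FinP.toℕ-injective (,-injectiveʳ eq)
  ; ext-distinct = λ eq → FinP.toℕ-injective (,-injectiveʳ eq)
  ; defs-unique = Data.List.Relation.Unary.AllPairs.[]
  ; ext-undefined = λ k () }
  where import Data.List.Relation.Unary.AllPairs

inrP : ∀ {X Y} → Prog Y (X ++ Y)
inrP {X} = record
  { ent = λ i → length X + toℕ i ; ext = toℕ ; defs = []
  ; ent-distinct = λ eq → FinP.toℕ-injective (ℕP.+-cancelˡ-≡ (length X) _ _ (,-injectiveʳ eq))
  ; ext-distinct = λ eq → FinP.toℕ-injective (,-injectiveʳ eq)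
  ; defs-unique = Data.List.Relation.Unary.AllPairs.[]
  ; ext-undefined = λ k () }
  where import Data.List.Relation.Unary.AllPairs

record FiniteCoproducts : Set where
  field
    ¡             : ∀ {X} → Prog [] X
    ¡-unique      : ∀ {X} (h : Prog [] X) → h ≈ ¡
    [_,_]         : ∀ {X Y Z} → Prog X Z → Prog Y Z → Prog (X ++ Y) Z
    copair-inl    : ∀ {X Y Z} (f : Prog X Z) (g : Prog Y Z) →
                    [ f , g ] ∘ inlP {X} {Y} ≈ f
    copair-inr    : ∀ {X Y Z} (f : Prog X Z) (g : Prog Y Z) →
                    [ f , g ] ∘ inrP {X} {Y} ≈ g
    copair-unique : ∀ {X Y Z} (f : Prog X Z) (g : Prog Y Z) (h : Prog (X ++ Y) Z) →
                    h ∘ inlP {X} {Y} ≈ f → h ∘ inrP {X} {Y} ≈ g → h ≈ [ f , g ]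

module CoproductMonoidal (C : FiniteCoproducts) where
  open FiniteCoproducts C

  infixr 8 _+ₘ_
  _+ₘ_ : ∀ {X X' Y Y'} → Prog X X' → Prog Y Y' → Prog (X ++ Y) (X' ++ Y')
  _+ₘ_ {X} {X'} {Y} {Y'} f g = [ inlP {X'} {Y'} ∘ f , inrP {X'} {Y'} ∘ g ]

  assoc : ∀ {X Y Z} → Prog (X ++ (Y ++ Z)) ((X ++ Y) ++ Z)
  assoc {X} {Y} {Z} =
    [ inlP {X ++ Y} {Z} ∘ inlP {X} {Y}
    , [ inlP {X ++ Y} {Z} ∘ inrP {X} {Y} , inrP {X ++ Y} {Z} ] ]

  assoc⁻¹ : ∀ {X Y Z} → Prog ((X ++ Y) ++ Z) (X ++ (Y ++ Z))
  assoc⁻¹ {X} {Y} {Z} =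
    [ [ inlP {X} {Y ++ Z} , inrP {X} {Y ++ Z} ∘ inlP {Y} {Z} ]
    , inrP {X} {Y ++ Z} ∘ inrP {Y} {Z} ]

  runit : ∀ {X} → Prog (X ++ []) X
  runit = [ idP , ¡ ]

  runit⁻¹ : ∀ {X} → Prog X (X ++ [])
  runit⁻¹ {X} = inlP {X} {[]}

  swap : ∀ {X Y} → Prog (X ++ Y) (Y ++ X)
  swap {X} {Y} = [ inrP {Y} {X} , inlP {Y} {X} ]

-- A uniform trace with respect to the coproducts (Hasegawa):
-- a family Tr^U_{X,Y} : 𝕋(X ++ U, Y ++ U) → 𝕋(X, Y), well defined on
-- equivalence classes, satisfying the axioms of a trace
-- (Joyal–Street–Verity) and uniformity.

record UniformTrace (C : FiniteCoproducts) : Set where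
  open CoproductMonoidal C
  field
    Tr : ∀ {X Y U} → Prog (X ++ U) (Y ++ U) → Prog X Y

    Tr-cong : ∀ {X Y U} {f g : Prog (X ++ U) (Y ++ U)} → f ≈ g → Tr {X} {Y} {U} f ≈ Tr g

    tightening-left : ∀ {X X' Y U} (g : Prog X' X) (f : Prog (X ++ U) (Y ++ U)) →
      Tr {X'} {Y} {U} (f ∘ (g +ₘ idP {U})) ≈ Tr f ∘ g

    tightening-right : ∀ {X Y Y' U} (f : Prog (X ++ U) (Y ++ U)) (h : Prog Y Y') →
      Tr {X} {Y'} {U} ((h +ₘ idP {U}) ∘ f) ≈ h ∘ Tr f

    sliding : ∀ {X Y U U'} (f : Prog (X ++ U) (Y ++ U')) (g : Prog U' U) →
      Tr {X} {Y} {U} ((idP {Y} +ₘ g) ∘ f) ≈ Tr {X} {Y} {U'} (f ∘ (idP {X} +ₘ g))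

    vanishing-unit : ∀ {X Y} (f : Prog (X ++ []) (Y ++ [])) →
      Tr {X} {Y} {[]} f ≈ runit ∘ f ∘ runit⁻¹

    vanishing-tensor : ∀ {X Y U V} (f : Prog (X ++ (U ++ V)) (Y ++ (U ++ V))) →
      Tr {X} {Y} {U ++ V} f
        ≈ Tr {X} {Y} {U} (Tr {X ++ U} {Y ++ U} {V} (assoc {Y} {U} {V} ∘ f ∘ assoc⁻¹ {X} {U} {V}))

    superposing : ∀ {W Z X Y U} (g : Prog W Z) (f : Prog (X ++ U) (Y ++ U)) →
      Tr {W ++ X} {Z ++ Y} {U} (assoc {Z} {Y} {U} ∘ (g +ₘ f) ∘ assoc⁻¹ {W} {X} {U})
        ≈ g +ₘ Tr f

    yanking : ∀ {U} → Tr {U} {U} {U} (swap {U} {U}) ≈ idP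

    uniformity : ∀ {X Y U U'} (f : Prog (X ++ U) (Y ++ U)) (g : Prog (X ++ U') (Y ++ U'))
      (h : Prog U U') →
      (idP {Y} +ₘ h) ∘ f ≈ g ∘ (idP {X} +ₘ h) → Tr {X} {Y} {U} f ≈ Tr {X} {Y} {U'} g

-- A program denotes the relation between entry and exit calls connected by its
-- call-traces, and two programs are equal exactly when these relations coincide, so
-- every law can be checked on denotations.  Composition denotes relational composition
-- (labels of the two programs are renamed apart into even and odd numbers, except that
-- the exits of the first become the entries of the second); programs without definitions
-- denote the graphs of the coproduct injections, and copairing runs two programs side by
-- side and merges their exits.  The trace of f adds, for each U-exit, a definition jumping
-- to the matching U-entry; it denotes the execution formula Trᴿ, which relates a to b when
-- f leads from a through finitely many U-elements to b.  Each trace axiom then becomes a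
-- statement about Trᴿ, proved by induction on such paths.

module Submission where

open import Defs
open import Level using (0ℓ)
open import Data.Empty using (⊥; ⊥-elim)
open import Data.Fin using (Fin; zero; suc; toℕ)
import Data.Fin.Properties as FinP
open import Data.List using (List; []; _∷_; _++_; length; lookup; map; allFin)
import Data.List.Relation.Unary.All as All
open import Data.List.Relation.Unary.Any using (here)
open import Data.List.Properties using (map-++; map-∘)
open import Data.List.Relation.Unary.Unique.Propositional using (Unique)
import Data.List.Relation.Unary.AllPairs as AllPairs
import Data.List.Relation.Unary.Unique.Propositional.Properties as UniqueP
open import Data.List.Membership.Propositional using (_∈_; _∉_)
open import Data.List.Membership.Propositional.Properties using (∈-map⁺; ∈-map⁻; ∈-++⁺ˡ; ∈-++⁺ʳ; ∈-++⁻; ∈-allFin)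
open import Data.List.Relation.Binary.Subset.Propositional using (_⊆_)
open import Data.Nat as ℕ using (ℕ; _+_)
import Data.Nat.Properties as NatP
open import Data.Product using (Σ; ∃; _×_; _,_; proj₁; proj₂)
open import Data.Product.Properties using (,-injectiveˡ; ,-injectiveʳ)
open import Data.Sum using (_⊎_; inj₁; inj₂; [_,_]; reduce; map₁; map₂; assocʳ; assocˡ) renaming (swap to ⊎-swap)
open import Data.Sum.Properties using (inj₁-injective; inj₂-injective)
open import Data.Sum.Relation.Binary.Pointwise using (Pointwise; inj₁; inj₂)
open import Function.Base using (case_of_)
open import Function.Definitions using (Injective)
open import Function.Bundles using (_⇔_; mk⇔; Equivalence)
open import Function.Construct.Identity using (⇔-id)
open import Function.Construct.Symmetry using (⇔-sym)
open import Function.Construct.Composition using (_⇔-∘_)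
open import Relation.Binary.Core using (REL)
open import Relation.Binary.Construct.Closure.ReflexiveTransitive using (Star; ε; _◅_; _◅◅_; gmap)
open import Relation.Binary.Construct.Closure.ReflexiveTransitive.Properties using (reflexive)
open import Relation.Nullary using (yes; no)
open import Relation.Binary.PropositionalEquality using (_≡_; _≢_; refl; sym; trans; cong; cong₂; subst; subst₂)

open Equivalence using (to; from)

infix 4 _≐_
_≐_ : ∀ {A B : Set} → REL A B 0ℓ → REL A B 0ℓ → Set
R ≐ S = ∀ a b → R a b ⇔ S a b

infixr 9 _⨟_
_⨟_ : ∀ {A B C : Set} → REL A B 0ℓ → REL B C 0ℓ → REL A C 0ℓ
(R ⨟ S) a c = ∃ λ b → R a b × S b c

≐-refl : ∀ {A B : Set} {R : REL A B 0ℓ} → R ≐ R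
≐-refl a b = ⇔-id _

≐-sym : ∀ {A B : Set} {R S : REL A B 0ℓ} → R ≐ S → S ≐ R
≐-sym R≐S a b = ⇔-sym (R≐S a b)

infixr 5 _⟫_
_⟫_ : ∀ {A B : Set} {R S T : REL A B 0ℓ} → R ≐ S → S ≐ T → R ≐ T
(R≐S ⟫ S≐T) a b = S≐T a b ⇔-∘ R≐S a b

⨟-cong : ∀ {A B C : Set} {R R′ : REL A B 0ℓ} {S S′ : REL B C 0ℓ} → R ≐ R′ → S ≐ S′ → R ⨟ S ≐ R′ ⨟ S′
⨟-cong R≐R′ S≐S′ a c =
  mk⇔ (λ (b , r , s) → b , to (R≐R′ a b) r , to (S≐S′ b c) s)
      (λ (b , r , s) → b , from (R≐R′ a b) r , from (S≐S′ b c) s)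

Pointwise-cong : ∀ {A B C D : Set} {R R′ : REL A B 0ℓ} {S S′ : REL C D 0ℓ} →
                 R ≐ R′ → S ≐ S′ → Pointwise R S ≐ Pointwise R′ S′
Pointwise-cong R≐R′ S≐S′ s t =
  mk⇔ (λ { (inj₁ r) → inj₁ (to (R≐R′ _ _) r) ; (inj₂ r) → inj₂ (to (S≐S′ _ _) r) })
      (λ { (inj₁ r) → inj₁ (from (R≐R′ _ _) r) ; (inj₂ r) → inj₂ (from (S≐S′ _ _) r) })

-- The execution formula on relations

-- Iter R s b: an R-path from s through finitely many states inj₂ u to the output inj₁ b.
module _ {A B U : Set} where

  data Iter (R : REL (A ⊎ U) (B ⊎ U) 0ℓ) : A ⊎ U → B → Set where
    exit : ∀ {s b} → R s (inj₁ b) → Iter R s b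
    loop : ∀ {s u b} → R s (inj₂ u) → Iter R (inj₂ u) b → Iter R s b

  Trᴿ : REL (A ⊎ U) (B ⊎ U) 0ℓ → REL A B 0ℓ
  Trᴿ R a b = Iter R (inj₁ a) b

  Iter-map : ∀ {R S : REL (A ⊎ U) (B ⊎ U) 0ℓ} → (∀ {s t} → R s t → S s t) →
             ∀ {s b} → Iter R s b → Iter S s b
  Iter-map h (exit r)   = exit (h r)
  Iter-map h (loop r p) = loop (h r) (Iter-map h p)

  Trᴿ-cong : ∀ {R S : REL (A ⊎ U) (B ⊎ U) 0ℓ} → R ≐ S → Trᴿ R ≐ Trᴿ S
  Trᴿ-cong R≐S a b = mk⇔ (Iter-map (to (R≐S _ _))) (Iter-map (from (R≐S _ _)))

module _ {A A′ B U : Set} (G : REL A′ A 0ℓ) (F : REL (A ⊎ U) (B ⊎ U) 0ℓ) where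
  private
    unsplit : ∀ {s m b} → Pointwise G _≡_ s m → Iter F m b → Iter (Pointwise G _≡_ ⨟ F) s b
    unsplit gm (exit fr)   = exit (_ , gm , fr)
    unsplit gm (loop fr p) = loop (_ , gm , fr) (unsplit (inj₂ refl) p)

    split : ∀ {s b} → Iter (Pointwise G _≡_ ⨟ F) s b → ∃ λ m → Pointwise G _≡_ s m × Iter F m b
    split (exit (m , gm , fr)) = m , gm , exit fr
    split (loop (m , gm , fr) p) with split p
    ... | _ , inj₂ refl , p′ = m , gm , loop fr p′

  Trᴿ-tightenˡ : Trᴿ (Pointwise G _≡_ ⨟ F) ≐ G ⨟ Trᴿ F
  Trᴿ-tightenˡ a′ b = mk⇔ ⇒ (λ (_ , g , p) → unsplit (inj₁ g) p)
    where
    ⇒ : Trᴿ (Pointwise G _≡_ ⨟ F) a′ b → (G ⨟ Trᴿ F) a′ b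
    ⇒ p with split p
    ... | _ , inj₁ g , p′ = _ , g , p′

module _ {A B B′ U : Set} (F : REL (A ⊎ U) (B ⊎ U) 0ℓ) (H : REL B B′ 0ℓ) where
  private
    unsplit : ∀ {s b b′} → Iter F s b → H b b′ → Iter (F ⨟ Pointwise H _≡_) s b′
    unsplit (exit fr)   h = exit (_ , fr , inj₁ h)
    unsplit (loop fr p) h = loop (_ , fr , inj₂ refl) (unsplit p h)

    split : ∀ {s b′} → Iter (F ⨟ Pointwise H _≡_) s b′ → ∃ λ b → Iter F s b × H b b′
    split (exit (inj₁ b , fr , inj₁ h)) = b , exit fr , h
    split (loop (inj₂ u , fr , inj₂ refl) p) with split p
    ... | b , p′ , h = b , loop fr p′ , h

  Trᴿ-tightenʳ : Trᴿ (F ⨟ Pointwise H _≡_) ≐ Trᴿ F ⨟ H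
  Trᴿ-tightenʳ a b′ = mk⇔ split (λ (_ , p , h) → unsplit p h)

module _ {A B U U′ : Set} (F : REL (A ⊎ U) (B ⊎ U′) 0ℓ) (G : REL U′ U 0ℓ) where
  private
    slideIn : ∀ {s s′ b} → Iter (F ⨟ Pointwise _≡_ G) s b → Pointwise _≡_ G s′ s →
              Iter (Pointwise _≡_ G ⨟ F) s′ b
    slideIn (exit (inj₁ _ , fr , inj₁ refl)) h = exit (_ , h , fr)
    slideIn (loop (inj₂ _ , fr , inj₂ g) p)  h = loop (_ , h , fr) (slideIn p (inj₂ g))

    slideOut : ∀ {s′ b} → Iter (Pointwise _≡_ G ⨟ F) s′ b →
               ∃ λ s → Pointwise _≡_ G s′ s × Iter (F ⨟ Pointwise _≡_ G) s b
    slideOut (exit (m , h , fr)) = m , h , exit (_ , fr , inj₁ refl)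
    slideOut (loop (m , h , fr) p) with slideOut p
    ... | _ , inj₂ g , p′ = m , h , loop (_ , fr , inj₂ g) p′

  Trᴿ-slide : Trᴿ (F ⨟ Pointwise _≡_ G) ≐ Trᴿ (Pointwise _≡_ G ⨟ F)
  Trᴿ-slide a b = mk⇔ (λ p → slideIn p (inj₁ refl)) ⇐
    where
    ⇐ : Trᴿ (Pointwise _≡_ G ⨟ F) a b → Trᴿ (F ⨟ Pointwise _≡_ G) a b
    ⇐ p with slideOut p
    ... | _ , inj₁ refl , p′ = p′

Trᴿ-vanish : ∀ {A B U : Set} (R : REL (A ⊎ U) (B ⊎ U) 0ℓ) → (U → ⊥) →
             Trᴿ R ≐ λ a b → R (inj₁ a) (inj₁ b)
Trᴿ-vanish R ¬U a b = mk⇔ (λ { (exit r) → r ; (loop {u = u} _ _) → ⊥-elim (¬U u) }) exit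

Trᴿ-yank : ∀ {A : Set} → Trᴿ (λ (s t : A ⊎ A) → ⊎-swap s ≡ t) ≐ _≡_
Trᴿ-yank a b = mk⇔ ⇒ λ { refl → loop refl (exit refl) }
  where
  ⇒ : Trᴿ (λ s t → ⊎-swap s ≡ t) a b → a ≡ b
  ⇒ (loop refl (exit refl))  = refl
  ⇒ (loop refl (loop () _))

module _ {A B U U′ : Set} (F : REL (A ⊎ U) (B ⊎ U) 0ℓ) (G : REL (A ⊎ U′) (B ⊎ U′) 0ℓ)
         (H : REL U U′ 0ℓ) (F⨟H≐H⨟G : F ⨟ Pointwise _≡_ H ≐ Pointwise _≡_ H ⨟ G) where
  private
    forward : ∀ {s b} → Iter F s b → ∃ λ s′ → Pointwise _≡_ H s s′ × Iter G s′ b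
    forward {s} {b} (exit fr) with to (F⨟H≐H⨟G s (inj₁ b)) (_ , fr , inj₁ refl)
    ... | s′ , h , gr = s′ , h , exit gr
    forward {s} (loop {u = u} fr p) with forward p
    ... | inj₂ u′ , inj₂ h′ , pg with to (F⨟H≐H⨟G s (inj₂ u′)) (inj₂ u , fr , inj₂ h′)
    ...   | s′ , h , gr = s′ , h , loop gr pg

    backward : ∀ {s s′ b} → Iter G s′ b → Pointwise _≡_ H s s′ → Iter F s b
    backward {s} {s′} {b} (exit gr) h with from (F⨟H≐H⨟G s (inj₁ b)) (s′ , h , gr)
    ... | inj₁ _ , fr , inj₁ refl = exit fr
    backward {s} {s′} (loop {u = u′} gr p) h with from (F⨟H≐H⨟G s (inj₂ u′)) (s′ , h , gr)
    ... | inj₂ _ , fr , inj₂ h′ = loop fr (backward p (inj₂ h′))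

  Trᴿ-uniform : Trᴿ F ≐ Trᴿ G
  Trᴿ-uniform a b = mk⇔ ⇒ (λ p → backward p (inj₁ refl))
    where
    ⇒ : Trᴿ F a b → Trᴿ G a b
    ⇒ p with forward p
    ... | _ , inj₁ refl , p′ = p′

module _ {A B U V : Set} (R : REL (A ⊎ (U ⊎ V)) (B ⊎ (U ⊎ V)) 0ℓ) where
  private
    R′ : REL ((A ⊎ U) ⊎ V) ((B ⊎ U) ⊎ V) 0ℓ
    R′ x y = R (assocʳ x) (assocʳ y)

    Inner : REL (A ⊎ U) (B ⊎ U) 0ℓ
    Inner = Trᴿ R′

    Resume : B ⊎ U → B → Set
    Resume (inj₁ b′) b = b′ ≡ b
    Resume (inj₂ u)  b = Iter Inner (inj₂ u) b

    mutual
      untilU : ∀ (x : (A ⊎ U) ⊎ V) {b} → Iter R (assocʳ x) b → ∃ λ t → Iter R′ x t × Resume t b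
      untilU x (exit r)                = inj₁ _ , exit r , refl
      untilU x (loop {u = inj₁ u} r p) = inj₂ u , exit r , nest (inj₂ u) p
      untilU x (loop {u = inj₂ v} r p) with untilU (inj₂ v) p
      ... | t , p′ , k = t , loop r p′ , k

      nest : ∀ (s : A ⊎ U) {b} → Iter R (assocʳ (inj₁ s)) b → Iter Inner s b
      nest s p with untilU (inj₁ s) p
      ... | inj₁ _ , p′ , refl = exit p′
      ... | inj₂ _ , p′ , k    = loop p′ k

    Resume′ : B ⊎ U → B → Set
    Resume′ (inj₁ b′) b = b′ ≡ b
    Resume′ (inj₂ u)  b = Iter R (inj₂ (inj₁ u)) b

    flattenInner : ∀ {x t b} → Iter R′ x t → Resume′ t b → Iter R (assocʳ x) b
    flattenInner {t = inj₁ _} (exit r) refl = exit r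
    flattenInner {t = inj₂ _} (exit r) k    = loop r k
    flattenInner (loop r p) k = loop r (flattenInner p k)

    flatten : ∀ {s b} → Iter Inner s b → Iter R (assocʳ (inj₁ s)) b
    flatten (exit p)   = flattenInner p refl
    flatten (loop p q) = flattenInner p (flatten q)

  Trᴿ-vanish⊎ : Trᴿ R ≐ Trᴿ (Trᴿ (λ x y → R (assocʳ x) (assocʳ y)))
  Trᴿ-vanish⊎ a b = mk⇔ (nest (inj₁ a)) flatten

module _ {W Z A B U : Set} (G : REL W Z 0ℓ) (F : REL (A ⊎ U) (B ⊎ U) 0ℓ) where
  private
    S : REL ((W ⊎ A) ⊎ U) ((Z ⊎ B) ⊎ U) 0ℓ
    S x y = Pointwise G F (assocʳ x) (assocʳ y)

    stepF : ∀ s t → S (map₁ inj₂ s) t → ∃ λ t′ → map₁ inj₂ t′ ≡ t × F s t′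
    stepF (inj₁ _) (inj₁ (inj₂ _)) (inj₂ r) = _ , refl , r
    stepF (inj₁ _) (inj₂ _)        (inj₂ r) = _ , refl , r
    stepF (inj₂ _) (inj₁ (inj₂ _)) (inj₂ r) = _ , refl , r
    stepF (inj₂ _) (inj₂ _)        (inj₂ r) = _ , refl , r

    restrict : ∀ s {y} → Iter S (map₁ inj₂ s) y → ∃ λ b → inj₂ b ≡ y × Iter F s b
    restrict s (exit {b = y} r) with stepF s (inj₁ y) r
    ... | inj₁ _ , refl , fr = _ , refl , exit fr
    restrict s (loop {u = u} r p) with stepF s (inj₂ u) r
    ... | inj₂ _ , refl , fr with restrict (inj₂ u) p
    ...   | b , eq , p′ = b , eq , loop fr p′

    extend : ∀ s {b} → Iter F s b → Iter S (map₁ inj₂ s) (inj₂ b)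
    extend (inj₁ _) (exit fr)   = exit (inj₂ fr)
    extend (inj₂ _) (exit fr)   = exit (inj₂ fr)
    extend (inj₁ _) (loop fr p) = loop (inj₂ fr) (extend _ p)
    extend (inj₂ _) (loop fr p) = loop (inj₂ fr) (extend _ p)

  Trᴿ-superpose : Trᴿ (λ x y → Pointwise G F (assocʳ x) (assocʳ y)) ≐ Pointwise G (Trᴿ F)
  Trᴿ-superpose (inj₁ w) (inj₁ z) =
    mk⇔ (λ { (exit (inj₁ g)) → inj₁ g ; (loop () _) }) (λ { (inj₁ g) → exit (inj₁ g) })
  Trᴿ-superpose (inj₁ w) (inj₂ b) = mk⇔ (λ { (exit ()) ; (loop () _) }) λ ()
  Trᴿ-superpose (inj₂ a) (inj₁ z) = mk⇔ (λ p → case restrict (inj₁ a) p of λ { (_ , () , _) }) λ ()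
  Trᴿ-superpose (inj₂ a) (inj₂ b) =
    mk⇔ (λ p → case restrict (inj₁ a) p of λ { (_ , refl , p′) → inj₂ p′ }) (λ { (inj₂ p) → extend (inj₁ a) p })

module _ {A A′ B B′ U : Set} (φ : A′ → A) (ψ : B′ → B) (R : REL (A ⊎ U) (B ⊎ U) 0ℓ) where
  private
    R′ : REL (A′ ⊎ U) (B′ ⊎ U) 0ℓ
    R′ x y = R (map₁ φ x) (map₁ ψ y)

    pull : ∀ {s₀ b₀} → Iter R s₀ b₀ → ∀ {s b} → map₁ φ s ≡ s₀ → ψ b ≡ b₀ → Iter R′ s b
    pull (exit r)   refl refl = exit r
    pull (loop r p) refl eq   = loop r (pull p refl eq)

    push : ∀ {s b} → Iter R′ s b → Iter R (map₁ φ s) (ψ b)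
    push (exit r)   = exit r
    push (loop r p) = loop r (push p)

  Trᴿ-reindex : ∀ a b → Trᴿ R (φ a) (ψ b) ⇔ Trᴿ (λ x y → R (map₁ φ x) (map₁ ψ y)) a b
  Trᴿ-reindex a b = mk⇔ (λ p → pull p refl refl) push

module _ {A B U U′ : Set} (φ : U′ → U) (φ-surjective : ∀ u → ∃ λ u′ → φ u′ ≡ u)
         (R : REL (A ⊎ U) (B ⊎ U) 0ℓ) where
  private
    R′ : REL (A ⊎ U′) (B ⊎ U′) 0ℓ
    R′ s t = R (map₂ φ s) (map₂ φ t)

    pull : ∀ {s₀ b} → Iter R s₀ b → ∀ {s} → map₂ φ s ≡ s₀ → Iter R′ s b
    pull (exit r) refl = exit r
    pull (loop {u = u} r p) refl with φ-surjective u
    ... | u′ , refl = loop r (pull p refl)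

    push : ∀ {s b} → Iter R′ s b → Iter R (map₂ φ s) b
    push (exit r)   = exit r
    push (loop r p) = loop r (push p)

  Trᴿ-reindex-loop : Trᴿ R ≐ Trᴿ (λ s t → R (map₂ φ s) (map₂ φ t))
  Trᴿ-reindex-loop a b = mk⇔ (λ p → pull p refl) push

record El (X : List Ty₀) : Set where
  constructor _▸_
  field
    idx : Fin (length X)
    val : Val (lookup X idx)
open El public

callAt : ∀ {X} → El X → ℕ → Call
callAt {X} e n = (lookup X (idx e) , n) , val e

finˡ : ∀ (X Y : List Ty₀) → Fin (length X) → Fin (length (X ++ Y))
finˡ (A ∷ X) Y zero    = zero
finˡ (A ∷ X) Y (suc i) = suc (finˡ X Y i)

finʳ : ∀ (X Y : List Ty₀) → Fin (length Y) → Fin (length (X ++ Y))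
finʳ []      Y j = j
finʳ (A ∷ X) Y j = suc (finʳ X Y j)

valˡ : ∀ (X Y : List Ty₀) (i : Fin (length X)) → Val (lookup X i) → Val (lookup (X ++ Y) (finˡ X Y i))
valˡ (A ∷ X) Y zero    v = v
valˡ (A ∷ X) Y (suc i) v = valˡ X Y i v

valʳ : ∀ (X Y : List Ty₀) (j : Fin (length Y)) → Val (lookup Y j) → Val (lookup (X ++ Y) (finʳ X Y j))
valʳ []      Y j v = v
valʳ (A ∷ X) Y j v = valʳ X Y j v

valʳ-surjective : ∀ (X Y : List Ty₀) (j : Fin (length Y)) (v : Val (lookup (X ++ Y) (finʳ X Y j))) → ∃ λ w → valʳ X Y j w ≡ v
valʳ-surjective []      Y j v = v , refl
valʳ-surjective (A ∷ X) Y j v = valʳ-surjective X Y j v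

lookup-finˡ : ∀ (X Y : List Ty₀) (i : Fin (length X)) → lookup (X ++ Y) (finˡ X Y i) ≡ lookup X i
lookup-finˡ (A ∷ X) Y zero    = refl
lookup-finˡ (A ∷ X) Y (suc i) = lookup-finˡ X Y i

lookup-finʳ : ∀ (X Y : List Ty₀) (j : Fin (length Y)) → lookup (X ++ Y) (finʳ X Y j) ≡ lookup Y j
lookup-finʳ []      Y j = refl
lookup-finʳ (A ∷ X) Y j = lookup-finʳ X Y j

toℕ-finˡ : ∀ (X Y : List Ty₀) (i : Fin (length X)) → toℕ (finˡ X Y i) ≡ toℕ i
toℕ-finˡ (A ∷ X) Y zero    = refl
toℕ-finˡ (A ∷ X) Y (suc i) = cong ℕ.suc (toℕ-finˡ X Y i)

toℕ-finʳ : ∀ (X Y : List Ty₀) (j : Fin (length Y)) → toℕ (finʳ X Y j) ≡ length X + toℕ j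
toℕ-finʳ []      Y j = refl
toℕ-finʳ (A ∷ X) Y j = cong ℕ.suc (toℕ-finʳ X Y j)

finˡ-injective : ∀ (X Y : List Ty₀) {i i′ : Fin (length X)} → finˡ X Y i ≡ finˡ X Y i′ → i ≡ i′
finˡ-injective (A ∷ X) Y {zero}  {zero}   eq = refl
finˡ-injective (A ∷ X) Y {suc i} {suc i′} eq = cong suc (finˡ-injective X Y (FinP.suc-injective eq))

finʳ-injective : ∀ (X Y : List Ty₀) {j j′ : Fin (length Y)} → finʳ X Y j ≡ finʳ X Y j′ → j ≡ j′
finʳ-injective []      Y eq = eq
finʳ-injective (A ∷ X) Y eq = finʳ-injective X Y (FinP.suc-injective eq)

finˡ≢finʳ : ∀ (X Y : List Ty₀) (i : Fin (length X)) (j : Fin (length Y)) → finˡ X Y i ≢ finʳ X Y j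
finˡ≢finʳ (A ∷ X) Y (suc i) j eq = finˡ≢finʳ X Y i j (FinP.suc-injective eq)

data FinView (X Y : List Ty₀) : Fin (length (X ++ Y)) → Set where
  onˡ : ∀ i → FinView X Y (finˡ X Y i)
  onʳ : ∀ j → FinView X Y (finʳ X Y j)

finView : ∀ (X Y : List Ty₀) k → FinView X Y k
finView []      Y k       = onʳ k
finView (A ∷ X) Y zero    = onˡ zero
finView (A ∷ X) Y (suc k) with finView X Y k
... | onˡ i = onˡ (suc i)
... | onʳ j = onʳ j

splitFin : ∀ (X Y : List Ty₀) → Fin (length (X ++ Y)) → Fin (length X) ⊎ Fin (length Y)
splitFin []      Y k       = inj₂ k
splitFin (A ∷ X) Y zero    = inj₁ zero
splitFin (A ∷ X) Y (suc k) = map₁ suc (splitFin X Y k)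

splitFin-finˡ : ∀ (X Y : List Ty₀) (i : Fin (length X)) → splitFin X Y (finˡ X Y i) ≡ inj₁ i
splitFin-finˡ (A ∷ X) Y zero    = refl
splitFin-finˡ (A ∷ X) Y (suc i) = cong (map₁ suc) (splitFin-finˡ X Y i)

splitFin-finʳ : ∀ (X Y : List Ty₀) (j : Fin (length Y)) → splitFin X Y (finʳ X Y j) ≡ inj₂ j
splitFin-finʳ []      Y j = refl
splitFin-finʳ (A ∷ X) Y j = cong (map₁ suc) (splitFin-finʳ X Y j)

injˡ : ∀ {X} Y → El X → El (X ++ Y)
injˡ {X} Y (i ▸ v) = finˡ X Y i ▸ valˡ X Y i v

injʳ : ∀ X {Y} → El Y → El (X ++ Y)
injʳ X {Y} (j ▸ v) = finʳ X Y j ▸ valʳ X Y j v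

join : ∀ {X Y} → El X ⊎ El Y → El (X ++ Y)
join {X} {Y} = [ injˡ Y , injʳ X ]

split : ∀ (X Y : List Ty₀) → El (X ++ Y) → El X ⊎ El Y
split []      Y e             = inj₂ e
split (A ∷ X) Y (zero  ▸ v)   = inj₁ (zero ▸ v)
split (A ∷ X) Y (suc k ▸ v)   = map₁ sucEl (split X Y (k ▸ v))
  where
  sucEl : El X → El (A ∷ X)
  sucEl (i ▸ w) = suc i ▸ w

join-split : ∀ (X Y : List Ty₀) e → join (split X Y e) ≡ e
join-split []      Y e           = refl
join-split (A ∷ X) Y (zero  ▸ v) = refl
join-split (A ∷ X) Y (suc k ▸ v) with split X Y (k ▸ v) | join-split X Y (k ▸ v)
... | inj₁ _ | refl = refl
... | inj₂ _ | refl = refl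

split-join : ∀ {X Y} s → split X Y (join s) ≡ s
split-join {A ∷ X}     (inj₁ (zero  ▸ v)) = refl
split-join {A ∷ X} {Y} (inj₁ (suc i ▸ v)) = cong (map₁ _) (split-join {X} {Y} (inj₁ (i ▸ v)))
split-join {[]}        (inj₂ b)           = refl
split-join {A ∷ X}     (inj₂ b)           = cong (map₁ _) (split-join {X} (inj₂ b))

join-injective : ∀ {X Y} {s s′ : El X ⊎ El Y} → join s ≡ join s′ → s ≡ s′
join-injective {X} {Y} {s} {s′} eq = trans (sym (split-join s)) (trans (cong (split X Y) eq) (split-join s′))

join≡join⇔≡ : ∀ {X Y} (s s′ : El X ⊎ El Y) → join s ≡ join s′ ⇔ s ≡ s′
join≡join⇔≡ s s′ = mk⇔ join-injective (cong join)

callAt-injˡ : ∀ (X Y : List Ty₀) (a : El X) n → callAt (injˡ Y a) n ≡ callAt a n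
callAt-injˡ (A ∷ X) Y (zero  ▸ v) n = refl
callAt-injˡ (A ∷ X) Y (suc i ▸ v) n = callAt-injˡ X Y (i ▸ v) n

callAt-injʳ : ∀ (X Y : List Ty₀) (b : El Y) n → callAt (injʳ X b) n ≡ callAt b n
callAt-injʳ []      Y (j ▸ v) n = refl
callAt-injʳ (A ∷ X) Y (j ▸ v) n = callAt-injʳ X Y (j ▸ v) n

StepIn : List Def → Call → Call → Set
StepIn ds (f , v) c = Σ (Body (argTy f)) λ b → ((f , b) ∈ ds) × (run b v ≡ c)

Star-⊆ : ∀ {ds D} → ds ⊆ D → ∀ {c c′} → Star (StepIn ds) c c′ → Star (StepIn D) c c′
Star-⊆ ds⊆D = gmap (λ c → c) (λ (b , b∈ , eq) → b , ds⊆D b∈ , eq)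

Star-[] : ∀ {c c′} → Star (StepIn []) c c′ → c ≡ c′
Star-[] ε            = refl
Star-[] ((_ , () , _) ◅ _)

renCall : (Ty₀ → ℕ → ℕ) → Call → Call
renCall ρ (l , v) = renL ρ l , v

run-renBody : ∀ ρ {A} (b : Body A) v → run (renBody ρ b) v ≡ renCall ρ (run b v)
run-renBody ρ (jump g e) v = refl
run-renBody ρ (case e g e₁ h e₂) v with eval e (v All.∷ All.[])
... | inl _ = refl
... | inr _ = refl

Star-ren : ∀ ρ ds {D} → map (renDef ρ) ds ⊆ D →
           ∀ {c c′} → Star (StepIn ds) c c′ → Star (StepIn D) (renCall ρ c) (renCall ρ c′)
Star-ren ρ ds ⊆D = gmap (renCall ρ) λ {(f , v)} (b , b∈ , eq) →
  renBody ρ b , ⊆D (∈-map⁺ (renDef ρ) b∈) , trans (run-renBody ρ b v) (cong (renCall ρ) eq)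

RenInjective : (Ty₀ → ℕ → ℕ) → Set
RenInjective ρ = ∀ {l l′} → renL ρ l ≡ renL ρ l′ → l ≡ l′

renCall-injective : ∀ {ρ} → RenInjective ρ → ∀ {c c′} → renCall ρ c ≡ renCall ρ c′ → c ≡ c′
renCall-injective inj {l , v} eq with inj (,-injectiveˡ eq)
... | refl with eq
... | refl = refl

Unrenames : (Ty₀ → ℕ → ℕ) → List Def → List Def → Set
Unrenames ρ D ds = ∀ {l b} → (renL ρ l , b) ∈ D → ∃ λ b₀ → ((l , b₀) ∈ ds) × (b ≡ renBody ρ b₀)

renDefs-unrenames : ∀ {ρ} → RenInjective ρ → ∀ ds → Unrenames ρ (map (renDef ρ) ds) ds
renDefs-unrenames inj ds d∈ with ∈-map⁻ (renDef _) d∈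
... | (l′ , b′) , b′∈ , eq with inj (,-injectiveˡ eq)
... | refl with eq
... | refl = b′ , b′∈ , refl

Star-unren : ∀ {ρ D ds} → Unrenames ρ D ds → ∀ {x y} → Star (StepIn D) x y →
             ∀ c → x ≡ renCall ρ c → ∃ λ c′ → (y ≡ renCall ρ c′) × Star (StepIn ds) c c′
Star-unren un ε c refl = c , refl , ε
Star-unren {ρ} un ((b , b∈ , eq) ◅ rest) (l , v) refl with un b∈
... | b₀ , b₀∈ , refl with Star-unren un rest (run b₀ v) (trans (sym eq) (run-renBody ρ b₀ v))
... | c′ , y≡ , t = c′ , y≡ , ((b₀ , b₀∈ , refl) ◅ t)

-- The relation denoted by a program

entC : ∀ {X Y} → Prog X Y → El X → Call
entC P a = entL P (idx a) , val a

extC : ∀ {X Y} → Prog X Y → El Y → Call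
extC P b = extL P (idx b) , val b

⟦_⟧ : ∀ {X Y} → Prog X Y → REL (El X) (El Y) 0ℓ
⟦ P ⟧ a b = Trace P (entC P a) (extC P b)

≈⇒≐ : ∀ {X Y} (P Q : Prog X Y) → P ≈ Q → ⟦ P ⟧ ≐ ⟦ Q ⟧
≈⇒≐ _ _ P≈Q a b = P≈Q (idx a) (val a) (idx b) (val b)

≐⇒≈ : ∀ {X Y} (P Q : Prog X Y) → ⟦ P ⟧ ≐ ⟦ Q ⟧ → P ≈ Q
≐⇒≈ _ _ P≐Q i v j w = P≐Q (i ▸ v) (j ▸ w)

dbl-injective : ∀ {m n} → dbl m ≡ dbl n → m ≡ n
dbl-injective {ℕ.zero}  {ℕ.zero}  eq = refl
dbl-injective {ℕ.suc m} {ℕ.suc n} eq = cong ℕ.suc (dbl-injective (NatP.suc-injective (NatP.suc-injective eq)))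

dbl≢suc-dbl : ∀ m n → dbl m ≢ ℕ.suc (dbl n)
dbl≢suc-dbl (ℕ.suc m) (ℕ.suc n) eq = dbl≢suc-dbl m n (NatP.suc-injective (NatP.suc-injective eq))

relabel : ∀ {C p B q m} {w : Val B} → _≡_ {A = Label} (C , p) (B , q) →
          ∃ λ u → _≡_ {A = Call} ((C , m) , u) ((B , m) , w) × _≡_ {A = Call} ((C , p) , u) ((B , q) , w)
relabel refl = _ , refl , refl

module ⨾-Semantics {X Y Z} (P : Prog X Y) (Q : Prog Y Z) where
  open Composite P Q using (ρP; ρQ; allDefs; view; hit; miss; renP-inj; renQ-inj; P-vs-Q; isEntQ)

  ρQ-entry : ∀ k → ρQ (lookup Y k) (ent Q k) ≡ dbl (ext P k)
  ρQ-entry k with isEntQ (lookup Y k) (ent Q k)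
  ... | yes (k′ , e) = cong (λ i → dbl (ext P i)) (ent-distinct Q e)
  ... | no ¬hit      = ⊥-elim (¬hit (k , refl))

  junction : ∀ b → renCall ρP (extC P b) ≡ renCall ρQ (entC Q b)
  junction (k ▸ u) = cong (λ n → (lookup Y k , n) , u) (sym (ρQ-entry k))

  glue : ∀ {a b c} → ⟦ P ⟧ a b → ⟦ Q ⟧ b c → ⟦ P ⨾ Q ⟧ a c
  glue {b = b} {c} tp tq =
    Star-ren ρP (defs P) ∈-++⁺ˡ tp ◅◅
    subst (λ x → Star (StepIn allDefs) x (renCall ρQ (extC Q c))) (sym (junction b))
      (Star-ren ρQ (defs Q) (∈-++⁺ʳ (map (renDef ρP) (defs P))) tq)

  Q-unrenames : Unrenames ρQ allDefs (defs Q)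
  Q-unrenames d∈ with ∈-++⁻ (map (renDef ρP) (defs P)) d∈
  ... | inj₂ d∈Q = renDefs-unrenames renQ-inj (defs Q) d∈Q
  ... | inj₁ d∈P with ∈-map⁻ (renDef ρP) d∈P
  ...   | _ , b∈ , eq = ⊥-elim (P-vs-Q (∈-map⁺ proj₁ b∈) (sym (,-injectiveˡ eq)))

  -- The labels of P are renamed to even numbers and the other labels of Q to odd
  -- ones, so an execution from an even label stays in P until it hits an entry of Q.
  cut : ∀ c {x y} → Star (StepIn allDefs) x y → ∀ {A m n} {v : Val A} →
        x ≡ ((A , m) , v) → m ≡ dbl n → y ≡ renCall ρQ (extC Q c) →
        ∃ λ b → Trace P ((A , n) , v) (extC P b) × ⟦ Q ⟧ b c
  cut (j ▸ w) ε refl m≡ refl with view (lookup Z j) (ext Q j)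
  ... | miss r = ⊥-elim (dbl≢suc-dbl _ _ (trans (sym m≡) r))
  ... | hit k e r with dbl-injective (trans (sym m≡) r)
  ...   | refl with relabel {m = ext P k} {w = w} e
  ...     | u , atP , atQ = k ▸ u , reflexive _ (sym atP) , reflexive _ atQ
  cut c ((b , b∈ , eq) ◅ rest) refl m≡ y≡ with ∈-++⁻ (map (renDef ρP) (defs P)) b∈
  ... | inj₁ b∈P with ∈-map⁻ (renDef ρP) b∈P
  ...   | ((A , n′) , b₀) , b₀∈ , refl with dbl-injective m≡
  ...     | refl with cut c rest (trans (sym eq) (run-renBody ρP b₀ _)) refl y≡
  ...       | b′ , tp , tq = b′ , (b₀ , b₀∈ , refl) ◅ tp , tq
  cut c ((b , b∈ , eq) ◅ rest) {v = v} refl m≡ y≡ | inj₂ b∈Q with ∈-map⁻ (renDef ρQ) b∈Q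
  ... | ((A , n′) , b₀) , b₀∈ , refl with view A n′
  ...   | miss r = ⊥-elim (dbl≢suc-dbl _ _ (trans (sym m≡) r))
  ...   | hit k e r with dbl-injective (trans (sym m≡) r)
  ...     | refl with relabel {m = ext P k} {w = v} e
  ...       | u , atP , atQ with Star-unren Q-unrenames rest (run b₀ v) (trans (sym eq) (run-renBody ρQ b₀ v))
  ...         | c′ , y≡′ , tq with renCall-injective renQ-inj (trans (sym y≡′) y≡)
  ...           | refl = k ▸ u , reflexive _ (sym atP) ,
                         subst (λ x → Trace Q x (extC Q c)) (sym atQ) ((b₀ , b₀∈ , refl) ◅ tq)

  cut-at-junction : ∀ {a c} → ⟦ P ⨾ Q ⟧ a c → (⟦ P ⟧ ⨟ ⟦ Q ⟧) a c
  cut-at-junction {i ▸ v} {c} t = cut c t refl refl refl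

⟦⨾⟧ : ∀ {X Y Z} (P : Prog X Y) (Q : Prog Y Z) → ⟦ P ⨾ Q ⟧ ≐ ⟦ P ⟧ ⨟ ⟦ Q ⟧
⟦⨾⟧ P Q a c = mk⇔ cut-at-junction (λ (_ , tp , tq) → glue tp tq)
  where open ⨾-Semantics P Q

-- Programs without definitions denote graphs of functions

Graph : ∀ {A B : Set} → (A → B) → REL A B 0ℓ
Graph f a b = f a ≡ b

Graph-⨟ : ∀ {A B C : Set} (f : A → B) (R : REL B C 0ℓ) → Graph f ⨟ R ≐ λ a c → R (f a) c
Graph-⨟ f R a c = mk⇔ (λ { (_ , refl , r) → r }) (λ r → _ , refl , r)

toCall : ∀ {X} → El X → Call
toCall e = callAt e (toℕ (idx e))

callAt-injective : ∀ {X} (g : ℕ → ℕ) → (∀ {m n} → g m ≡ g n → m ≡ n) → ∀ {e e′ : El X} →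
                   callAt e (g (toℕ (idx e))) ≡ callAt e′ (g (toℕ (idx e′))) → e ≡ e′
callAt-injective g g-inj {i ▸ v} {j ▸ w} eq with FinP.toℕ-injective (g-inj (cong (λ c → proj₂ (proj₁ c)) eq))
... | refl with eq
... | refl = refl

toCall-injective : ∀ {X} {e e′ : El X} → toCall e ≡ toCall e′ → e ≡ e′
toCall-injective = callAt-injective (λ n → n) (λ eq → eq)

⟦idP⟧ : ∀ {X} → ⟦ idP {X} ⟧ ≐ _≡_
⟦idP⟧ a b = mk⇔ (λ t → toCall-injective (Star-[] t)) λ { refl → ε }

entC-inlP : ∀ {X Y} (a : El X) → entC (inlP {X} {Y}) a ≡ toCall (injˡ Y a)
entC-inlP {X} {Y} (i ▸ v) =
  sym (trans (cong (callAt (injˡ {X} Y (i ▸ v))) (toℕ-finˡ X Y i)) (callAt-injˡ X Y (i ▸ v) _))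

entC-inrP : ∀ {X Y} (b : El Y) → entC (inrP {X} {Y}) b ≡ toCall (injʳ X b)
entC-inrP {X} {Y} (j ▸ v) =
  sym (trans (cong (callAt (injʳ X {Y} (j ▸ v))) (toℕ-finʳ X Y j)) (callAt-injʳ X Y (j ▸ v) _))

⟦inlP⟧ : ∀ {X Y} → ⟦ inlP {X} {Y} ⟧ ≐ Graph (injˡ Y)
⟦inlP⟧ {X} {Y} a e =
  mk⇔ (λ t → toCall-injective (trans (sym (entC-inlP a)) (Star-[] t)))
      (λ { refl → reflexive _ (entC-inlP a) })

⟦inrP⟧ : ∀ {X Y} → ⟦ inrP {X} {Y} ⟧ ≐ Graph (injʳ X)
⟦inrP⟧ {X} {Y} b e =
  mk⇔ (λ t → toCall-injective (trans (sym (entC-inrP b)) (Star-[] t)))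
      (λ { refl → reflexive _ (entC-inrP b) })

evenRen oddRen : Ty₀ → ℕ → ℕ
evenRen _ n = dbl n
oddRen  _ n = ℕ.suc (dbl n)

evenRen-injective : RenInjective evenRen
evenRen-injective {A , n} eq with ,-injectiveˡ eq | dbl-injective (,-injectiveʳ eq)
... | refl | refl = refl

oddRen-injective : RenInjective oddRen
oddRen-injective {A , n} eq with ,-injectiveˡ eq | dbl-injective (NatP.suc-injective (,-injectiveʳ eq))
... | refl | refl = refl

evenRen≢oddRen : ∀ {l l′} → renL evenRen l ≢ renL oddRen l′
evenRen≢oddRen {_ , n} {_ , n′} eq = dbl≢suc-dbl n n′ (,-injectiveʳ eq)

defined-renDefs : ∀ ρ ds → map proj₁ (map (renDef ρ) ds) ≡ map (renL ρ) (map proj₁ ds)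
defined-renDefs ρ ds = trans (sym (map-∘ {g = proj₁} {f = renDef ρ} ds)) (map-∘ {g = renL ρ} {f = proj₁} ds)

module Interleave (X Y : List Ty₀) (m : Fin (length X) → ℕ) (n : Fin (length Y) → ℕ) where

  number : Fin (length (X ++ Y)) → ℕ
  number k = [ (λ i → dbl (m i)) , (λ j → ℕ.suc (dbl (n j))) ] (splitFin X Y k)

  label : Fin (length (X ++ Y)) → Label
  label k = lookup (X ++ Y) k , number k

  label-finˡ : ∀ i → label (finˡ X Y i) ≡ renL evenRen (lookup X i , m i)
  label-finˡ i = cong₂ _,_ (lookup-finˡ X Y i) (cong [ _ , _ ] (splitFin-finˡ X Y i))

  label-finʳ : ∀ j → label (finʳ X Y j) ≡ renL oddRen (lookup Y j , n j)
  label-finʳ j = cong₂ _,_ (lookup-finʳ X Y j) (cong [ _ , _ ] (splitFin-finʳ X Y j))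

  label-injective : Injective _≡_ _≡_ (λ i → lookup X i , m i) → Injective _≡_ _≡_ (λ j → lookup Y j , n j) →
                    Injective _≡_ _≡_ label
  label-injective injX injY {k} {k′} eq with finView X Y k | finView X Y k′
  ... | onˡ i | onˡ i′ = cong (finˡ X Y) (injX (evenRen-injective (trans (sym (label-finˡ i)) (trans eq (label-finˡ i′)))))
  ... | onʳ j | onʳ j′ = cong (finʳ X Y) (injY (oddRen-injective (trans (sym (label-finʳ j)) (trans eq (label-finʳ j′)))))
  ... | onˡ i | onʳ j′ = ⊥-elim (evenRen≢oddRen (trans (sym (label-finˡ i)) (trans eq (label-finʳ j′))))
  ... | onʳ j | onˡ i′ = ⊥-elim (evenRen≢oddRen (trans (sym (label-finˡ i′)) (trans (sym eq) (label-finʳ j))))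

  callAt-injˡ-number : ∀ (a : El X) → callAt (injˡ Y a) (number (idx (injˡ Y a))) ≡ renCall evenRen (callAt a (m (idx a)))
  callAt-injˡ-number (i ▸ v) =
    trans (cong (callAt (injˡ {X} Y (i ▸ v))) (cong [ _ , _ ] (splitFin-finˡ X Y i))) (callAt-injˡ X Y (i ▸ v) _)

  callAt-injʳ-number : ∀ (b : El Y) → callAt (injʳ X b) (number (idx (injʳ X b))) ≡ renCall oddRen (callAt b (n (idx b)))
  callAt-injʳ-number (j ▸ v) =
    trans (cong (callAt (injʳ X {Y} (j ▸ v))) (cong [ _ , _ ] (splitFin-finʳ X Y j))) (callAt-injʳ X Y (j ▸ v) _)

module ⊕-Construction {X Y Z W : List Ty₀} (f : Prog X Z) (g : Prog Y W) where
  private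
    module Ent = Interleave X Y (ent f) (ent g)
    module Ext = Interleave Z W (ext f) (ext g)

  defsS : List Def
  defsS = map (renDef evenRen) (defs f) ++ map (renDef oddRen) (defs g)

  defined-defsS : map proj₁ defsS ≡ map (renL evenRen) (defined f) ++ map (renL oddRen) (defined g)
  defined-defsS = trans (map-++ proj₁ (map (renDef evenRen) (defs f)) (map (renDef oddRen) (defs g)))
                        (cong₂ _++_ (defined-renDefs evenRen (defs f)) (defined-renDefs oddRen (defs g)))

  defsS-unique : Unique (map proj₁ defsS)
  defsS-unique = subst Unique (sym defined-defsS)
    (UniqueP.++⁺ (UniqueP.map⁺ evenRen-injective (defs-unique f)) (UniqueP.map⁺ oddRen-injective (defs-unique g))
      λ (l∈f , l∈g) → case ∈-map⁻ (renL evenRen) l∈f , ∈-map⁻ (renL oddRen) l∈g of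
        λ { ((_ , _ , e) , (_ , _ , e′)) → evenRen≢oddRen (trans (sym e) e′) })

  exits-undefined : ∀ k → Ext.label k ∉ map proj₁ defsS
  exits-undefined k l∈ with finView Z W k | subst (Ext.label k ∈_) defined-defsS l∈
  ... | onˡ i | l∈′ with ∈-++⁻ (map (renL evenRen) (defined f)) (subst (_∈ _) (Ext.label-finˡ i) l∈′)
  ...   | inj₁ l∈f = case ∈-map⁻ (renL evenRen) l∈f of
                       λ { (_ , l∈ , e) → ext-undefined f i (subst (_∈ defined f) (sym (evenRen-injective e)) l∈) }
  ...   | inj₂ l∈g = case ∈-map⁻ (renL oddRen) l∈g of λ { (_ , _ , e) → evenRen≢oddRen e }
  exits-undefined k l∈ | onʳ j | l∈′ with ∈-++⁻ (map (renL evenRen) (defined f)) (subst (_∈ _) (Ext.label-finʳ j) l∈′)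
  ...   | inj₂ l∈g = case ∈-map⁻ (renL oddRen) l∈g of
                       λ { (_ , l∈ , e) → ext-undefined g j (subst (_∈ defined g) (sym (oddRen-injective e)) l∈) }
  ...   | inj₁ l∈f = case ∈-map⁻ (renL evenRen) l∈f of λ { (_ , _ , e) → evenRen≢oddRen (sym e) }

  sum : Prog (X ++ Y) (Z ++ W)
  sum = record
    { ent = Ent.number ; ext = Ext.number ; defs = defsS
    ; ent-distinct  = Ent.label-injective (ent-distinct f) (ent-distinct g)
    ; ext-distinct  = Ext.label-injective (ext-distinct f) (ext-distinct g)
    ; defs-unique   = defsS-unique
    ; ext-undefined = exits-undefined }

  f-unrenames : Unrenames evenRen defsS (defs f)
  f-unrenames d∈ with ∈-++⁻ (map (renDef evenRen) (defs f)) d∈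
  ... | inj₁ d∈f = renDefs-unrenames evenRen-injective (defs f) d∈f
  ... | inj₂ d∈g = case ∈-map⁻ (renDef oddRen) d∈g of λ { (_ , _ , e) → ⊥-elim (evenRen≢oddRen (,-injectiveˡ e)) }

  g-unrenames : Unrenames oddRen defsS (defs g)
  g-unrenames d∈ with ∈-++⁻ (map (renDef evenRen) (defs f)) d∈
  ... | inj₂ d∈g = renDefs-unrenames oddRen-injective (defs g) d∈g
  ... | inj₁ d∈f = case ∈-map⁻ (renDef evenRen) d∈f of λ { (_ , _ , e) → ⊥-elim (evenRen≢oddRen (sym (,-injectiveˡ e))) }

  ⊕-injˡ⁺ : ∀ {a a′} → ⟦ f ⟧ a a′ → ⟦ sum ⟧ (injˡ Y a) (injˡ W a′)
  ⊕-injˡ⁺ {a} {a′} t = subst₂ (Star (StepIn defsS)) (sym (Ent.callAt-injˡ-number a)) (sym (Ext.callAt-injˡ-number a′))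
                              (Star-ren evenRen (defs f) ∈-++⁺ˡ t)

  ⊕-injʳ⁺ : ∀ {b b′} → ⟦ g ⟧ b b′ → ⟦ sum ⟧ (injʳ X b) (injʳ Z b′)
  ⊕-injʳ⁺ {b} {b′} t = subst₂ (Star (StepIn defsS)) (sym (Ent.callAt-injʳ-number b)) (sym (Ext.callAt-injʳ-number b′))
                              (Star-ren oddRen (defs g) (∈-++⁺ʳ (map (renDef evenRen) (defs f))) t)

  ⊕-injˡ⁻ : ∀ {a t} → ⟦ sum ⟧ (injˡ Y a) t → ∃ λ a′ → injˡ W a′ ≡ t × ⟦ f ⟧ a a′
  ⊕-injˡ⁻ {a} {t} tr with Star-unren f-unrenames tr (entC f a) (Ent.callAt-injˡ-number a)
  ... | c′ , t≡ , tf with split Z W t | join-split Z W t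
  ...   | inj₁ a′ | refl with renCall-injective evenRen-injective (trans (sym (Ext.callAt-injˡ-number a′)) t≡)
  ...     | refl = a′ , refl , tf
  ⊕-injˡ⁻ tr | c′ , t≡ , tf | inj₂ b′ | refl =
    ⊥-elim (evenRen≢oddRen (sym (cong proj₁ (trans (sym (Ext.callAt-injʳ-number b′)) t≡))))

  ⊕-injʳ⁻ : ∀ {b t} → ⟦ sum ⟧ (injʳ X b) t → ∃ λ b′ → injʳ Z b′ ≡ t × ⟦ g ⟧ b b′
  ⊕-injʳ⁻ {b} {t} tr with Star-unren g-unrenames tr (entC g b) (Ent.callAt-injʳ-number b)
  ... | c′ , t≡ , tg with split Z W t | join-split Z W t
  ...   | inj₂ b′ | refl with renCall-injective oddRen-injective (trans (sym (Ext.callAt-injʳ-number b′)) t≡)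
  ...     | refl = b′ , refl , tg
  ⊕-injʳ⁻ tr | c′ , t≡ , tg | inj₁ a′ | refl =
    ⊥-elim (evenRen≢oddRen (cong proj₁ (trans (sym (Ext.callAt-injˡ-number a′)) t≡)))

coerce : ∀ {A B} → A ≡ B → Exp (A ∷ []) B
coerce refl = var (here refl)

run-coerce : ∀ {A B} (A≡B : A ≡ B) n (v : Val A) → run (jump (B , n) (coerce A≡B)) v ≡ ((A , n) , v)
run-coerce refl n v = refl

Star-undefined : ∀ {D x y} → (∀ b → (proj₁ x , b) ∉ D) → Star (StepIn D) x y → x ≡ y
Star-undefined undef ε                  = refl
Star-undefined undef ((b , b∈ , _) ◅ _) = ⊥-elim (undef b b∈)

module Codiagonal (Z : List Ty₀) where

  merge : Fin (length (Z ++ Z)) → Fin (length Z)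
  merge k = reduce (splitFin Z Z k)

  merge-join : ∀ (t : El Z ⊎ El Z) → merge (idx (join {Z} t)) ≡ idx (reduce t)
  merge-join (inj₁ (i ▸ _)) = cong reduce (splitFin-finˡ Z Z i)
  merge-join (inj₂ (j ▸ _)) = cong reduce (splitFin-finʳ Z Z j)

  lookup-merge : ∀ k → lookup (Z ++ Z) k ≡ lookup Z (merge k)
  lookup-merge k with finView Z Z k
  ... | onˡ i = trans (lookup-finˡ Z Z i) (cong (lookup Z) (sym (cong reduce (splitFin-finˡ Z Z i))))
  ... | onʳ j = trans (lookup-finʳ Z Z j) (cong (lookup Z) (sym (cong reduce (splitFin-finʳ Z Z j))))

  entryLabel : Fin (length (Z ++ Z)) → Label
  entryLabel k = lookup (Z ++ Z) k , ℕ.suc (dbl (toℕ k))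

  entryLabel-injective : Injective _≡_ _≡_ entryLabel
  entryLabel-injective eq = FinP.toℕ-injective (dbl-injective (NatP.suc-injective (,-injectiveʳ eq)))

  forward : ∀ k → Body (lookup (Z ++ Z) k)
  forward k = jump (lookup Z (merge k) , dbl (toℕ (merge k))) (coerce (lookup-merge k))

  forwardDef : Fin (length (Z ++ Z)) → Def
  forwardDef k = entryLabel k , forward k

  defsC : List Def
  defsC = map forwardDef (allFin (length (Z ++ Z)))

  even-undefined : ∀ A n → ∀ b → ((A , dbl n) , b) ∉ defsC
  even-undefined A n b d∈ with ∈-map⁻ forwardDef d∈
  ... | _ , _ , e = dbl≢suc-dbl _ _ (,-injectiveʳ (,-injectiveˡ e))

  codiag : Prog (Z ++ Z) Z
  codiag = record
    { ent = λ k → ℕ.suc (dbl (toℕ k)) ; ext = λ k → dbl (toℕ k) ; defs = defsC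
    ; ent-distinct  = entryLabel-injective
    ; ext-distinct  = λ eq → FinP.toℕ-injective (dbl-injective (,-injectiveʳ eq))
    ; defs-unique   = subst Unique (map-∘ (allFin _)) (UniqueP.map⁺ entryLabel-injective (UniqueP.allFin⁺ _))
    ; ext-undefined = λ k d∈ → case ∈-map⁻ proj₁ d∈ of λ { ((_ , b) , d∈′ , refl) → even-undefined _ _ b d∈′ } }

  forward-step : ∀ e → StepIn defsC (entC codiag e) (callAt e (dbl (toℕ (merge (idx e)))))
  forward-step e = forward (idx e) , ∈-map⁺ forwardDef (∈-allFin (idx e)) , run-coerce (lookup-merge (idx e)) _ (val e)

  forward-only : ∀ e c {y} → Star (StepIn defsC) (entC codiag e) y → y ≡ extC codiag c →
                 callAt e (dbl (toℕ (merge (idx e)))) ≡ extC codiag c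
  forward-only e c ε y≡ = ⊥-elim (dbl≢suc-dbl _ _ (sym (,-injectiveʳ (,-injectiveˡ y≡))))
  forward-only e c ((b , b∈ , eq) ◅ rest) refl with ∈-map⁻ forwardDef b∈
  ... | k , _ , deq with entryLabel-injective (,-injectiveˡ deq)
  ... | refl with deq
  ... | refl with trans (sym eq) (run-coerce (lookup-merge (idx e)) _ (val e))
  ... | refl = Star-undefined (even-undefined _ _) rest

  callAt-join-merge : ∀ (t : El Z ⊎ El Z) → callAt (join {Z} t) (dbl (toℕ (merge (idx (join {Z} t))))) ≡ extC codiag (reduce t)
  callAt-join-merge t@(inj₁ a) = trans (cong (λ i → callAt (injˡ {Z} Z a) (dbl (toℕ i))) (merge-join t)) (callAt-injˡ Z Z a _)
  callAt-join-merge t@(inj₂ b) = trans (cong (λ i → callAt (injʳ Z {Z} b) (dbl (toℕ i))) (merge-join t)) (callAt-injʳ Z Z b _)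

  ⟦codiag⟧ : ∀ (t : El Z ⊎ El Z) c → ⟦ codiag ⟧ (join t) c ⇔ reduce t ≡ c
  ⟦codiag⟧ t c = mk⇔
    (λ tr → callAt-injective dbl dbl-injective (trans (sym (callAt-join-merge t)) (forward-only (join t) c tr refl)))
    (λ { refl → forward-step (join t) ◅ reflexive _ (callAt-join-merge t) })

-- Opaque because unfolding the composite program makes unification with its denotation blow up.
opaque
  copair : ∀ {X Y Z} → Prog X Z → Prog Y Z → Prog (X ++ Y) Z
  copair {Z = Z} f g = ⊕-Construction.sum f g ⨾ Codiagonal.codiag Z

opaque
  unfolding copair

  ⟦copair⟧ˡ : ∀ {X Y Z} (f : Prog X Z) (g : Prog Y Z) → (λ a c → ⟦ copair f g ⟧ (injˡ Y a) c) ≐ ⟦ f ⟧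
  ⟦copair⟧ˡ {Z = Z} f g a c = mk⇔
    (λ t → case to (⟦⨾⟧ sum codiag _ c) t of λ { (_ , t₁ , t₂) → case ⊕-injˡ⁻ t₁ of
             λ { (a′ , refl , tf) → subst (⟦ f ⟧ a) (to (⟦codiag⟧ (inj₁ a′) c) t₂) tf } })
    (λ t → from (⟦⨾⟧ sum codiag _ c) (_ , ⊕-injˡ⁺ t , from (⟦codiag⟧ (inj₁ c) c) refl))
    where open ⊕-Construction f g
          open Codiagonal Z

  ⟦copair⟧ʳ : ∀ {X Y Z} (f : Prog X Z) (g : Prog Y Z) → (λ b c → ⟦ copair f g ⟧ (injʳ X b) c) ≐ ⟦ g ⟧
  ⟦copair⟧ʳ {Z = Z} f g b c = mk⇔
    (λ t → case to (⟦⨾⟧ sum codiag _ c) t of λ { (_ , t₁ , t₂) → case ⊕-injʳ⁻ t₁ of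
             λ { (b′ , refl , tg) → subst (⟦ g ⟧ b) (to (⟦codiag⟧ (inj₂ b′) c) t₂) tg } })
    (λ t → from (⟦⨾⟧ sum codiag _ c) (_ , ⊕-injʳ⁺ t , from (⟦codiag⟧ (inj₂ c) c) refl))
    where open ⊕-Construction f g
          open Codiagonal Z

-- Feeding the U-exits of a program back into its U-entries

⟦_⟧₊ : ∀ {X U Y V} → Prog (X ++ U) (Y ++ V) → REL (El X ⊎ El U) (El Y ⊎ El V) 0ℓ
⟦ f ⟧₊ s t = ⟦ f ⟧ (join s) (join t)

module Feedback {X Y U : List Ty₀} (f : Prog (X ++ U) (Y ++ U)) where

  entT : Fin (length X) → ℕ
  entT i = ent f (finˡ X U i)

  extT : Fin (length Y) → ℕ
  extT j = ext f (finˡ Y U j)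

  loopLabel : Fin (length U) → Label
  loopLabel u = extL f (finʳ Y U u)

  loopTy : ∀ u → lookup (Y ++ U) (finʳ Y U u) ≡ lookup (X ++ U) (finʳ X U u)
  loopTy u = trans (lookup-finʳ Y U u) (sym (lookup-finʳ X U u))

  loopDef : Fin (length U) → Def
  loopDef u = loopLabel u , jump (entL f (finʳ X U u)) (coerce (loopTy u))

  defsT : List Def
  defsT = defs f ++ map loopDef (allFin (length U))

  entT-label : ∀ i → (lookup X i , entT i) ≡ entL f (finˡ X U i)
  entT-label i = cong (_, entT i) (sym (lookup-finˡ X U i))

  extT-label : ∀ j → (lookup Y j , extT j) ≡ extL f (finˡ Y U j)
  extT-label j = cong (_, extT j) (sym (lookup-finˡ Y U j))

  defined-defsT : map proj₁ defsT ≡ defined f ++ map loopLabel (allFin (length U))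
  defined-defsT = trans (map-++ proj₁ (defs f) _) (cong (defined f ++_) (sym (map-∘ (allFin (length U)))))

  defsT-unique : Unique (map proj₁ defsT)
  defsT-unique = subst Unique (sym defined-defsT)
    (UniqueP.++⁺ (defs-unique f) (UniqueP.map⁺ (λ eq → finʳ-injective Y U (ext-distinct f eq)) (UniqueP.allFin⁺ _))
      λ (l∈f , l∈loops) → case ∈-map⁻ loopLabel l∈loops of λ { (u , _ , refl) → ext-undefined f (finʳ Y U u) l∈f })

  exits-undefined : ∀ j → (lookup Y j , extT j) ∉ map proj₁ defsT
  exits-undefined j l∈ with ∈-++⁻ (defined f) (subst (_∈ defined f ++ map loopLabel (allFin (length U))) (extT-label j)
                                                      (subst ((lookup Y j , extT j) ∈_) defined-defsT l∈))
  ... | inj₁ l∈f     = ext-undefined f (finˡ Y U j) l∈f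
  ... | inj₂ l∈loops = case ∈-map⁻ loopLabel l∈loops of λ { (u , _ , e) → finˡ≢finʳ Y U j u (ext-distinct f e) }

  trace : Prog X Y
  trace = record
    { ent = entT ; ext = extT ; defs = defsT
    ; ent-distinct  = λ {i} {i′} eq → finˡ-injective X U (ent-distinct f (trans (sym (entT-label i)) (trans eq (entT-label i′))))
    ; ext-distinct  = λ {j} {j′} eq → finˡ-injective Y U (ext-distinct f (trans (sym (extT-label j)) (trans eq (extT-label j′))))
    ; defs-unique   = defsT-unique
    ; ext-undefined = exits-undefined }

  entC-trace : ∀ x → entC f (injˡ U x) ≡ entC trace x
  entC-trace x = callAt-injˡ X U x _

  extC-trace : ∀ y → extC f (injˡ U y) ≡ extC trace y
  extC-trace y = callAt-injˡ Y U y _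

  loop-run : ∀ u (w : Val (lookup U u)) →
             run (proj₂ (loopDef u)) (valʳ Y U u w) ≡ entC f (injʳ X (u ▸ w))
  loop-run u w = trans (run-coerce (loopTy u) _ (valʳ Y U u w))
                       (trans (callAt-injʳ Y U (u ▸ w) _) (sym (callAt-injʳ X U (u ▸ w) _)))

  loop-step : ∀ u → StepIn defsT (extC f (injʳ Y u)) (entC f (injʳ X u))
  loop-step (u ▸ w) = _ , ∈-++⁺ʳ (defs f) (∈-map⁺ loopDef (∈-allFin u)) , loop-run u w

  iter⇒run : ∀ {s y} → Iter ⟦ f ⟧₊ s y → Trace trace (entC f (join s)) (extC trace y)
  iter⇒run {s} {y} (exit r) = subst (Star (StepIn defsT) _) (extC-trace y) (Star-⊆ ∈-++⁺ˡ r)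
  iter⇒run (loop {u = u} r p) = Star-⊆ ∈-++⁺ˡ r ◅◅ (loop-step u ◅ iter⇒run p)

  Continues : El Y → Call → Set
  Continues y c = Trace f c (extC f (injˡ U y)) ⊎ (∃ λ u → Trace f c (extC f (injʳ Y u)) × Iter ⟦ f ⟧₊ (inj₂ u) y)

  continue : ∀ {u y} → Continues y (entC f (injʳ X u)) → Iter ⟦ f ⟧₊ (inj₂ u) y
  continue (inj₁ t)            = exit t
  continue (inj₂ (_ , t , p)) = loop t p

  run⇒continues : ∀ {y c z} → Star (StepIn defsT) c z → z ≡ extC trace y → Continues y c
  run⇒continues {y} ε z≡ = inj₁ (reflexive _ (trans z≡ (sym (extC-trace y))))
  run⇒continues {y} {(A , n) , v} ((b , b∈ , eq) ◅ rest) z≡ with ∈-++⁻ (defs f) b∈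
  ... | inj₁ b∈f = [ (λ t → inj₁ ((b , b∈f , eq) ◅ t)) , (λ (u , t , p) → inj₂ (u , (b , b∈f , eq) ◅ t , p)) ] (run⇒continues rest z≡)
  ... | inj₂ b∈loops with ∈-map⁻ loopDef b∈loops
  ...   | u , _ , refl with valʳ-surjective Y U u v
  ...     | w , refl = inj₂ ((u ▸ w) , ε , continue (subst (Continues y) (trans (sym eq) (loop-run u w)) (run⇒continues rest z≡)))

  ⟦trace⟧ : ⟦ trace ⟧ ≐ Trᴿ ⟦ f ⟧₊
  ⟦trace⟧ x y = mk⇔
    (λ t → case run⇒continues (subst (λ c → Trace trace c (extC trace y)) (sym (entC-trace x)) t) refl of
      λ { (inj₁ t′) → exit t′ ; (inj₂ (_ , t′ , p)) → loop t′ p })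
    (λ p → subst (λ c → Trace trace c (extC trace y)) (entC-trace x) (iter⇒run p))

-- Finite coproducts

≐-join : ∀ {X Y} {C : Set} {R S : REL (El (X ++ Y)) C 0ℓ} →
         (λ s c → R (join s) c) ≐ (λ s c → S (join s) c) → R ≐ S
≐-join {X} {Y} {R = R} {S} h e c = subst (λ e → R e c ⇔ S e c) (join-split X Y e) (h (split X Y e) c)

≐-join₂ : ∀ {X Y U V} {R S : REL (El (X ++ U)) (El (Y ++ V)) 0ℓ} →
          (λ s t → R (join s) (join t)) ≐ (λ s t → S (join s) (join t)) → R ≐ S
≐-join₂ {X} {Y} {U} {V} {R} {S} h e e′ =
  subst₂ (λ e e′ → R e e′ ⇔ S e e′) (join-split X U e) (join-split Y V e′) (h (split X U e) (split Y V e′))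

⨟-join : ∀ {Y U} {A C : Set} (R : REL A (El (Y ++ U)) 0ℓ) (S : REL (El (Y ++ U)) C 0ℓ) →
         R ⨟ S ≐ (λ a m → R a (join m)) ⨟ (λ m c → S (join m) c)
⨟-join {Y} {U} R S a c = mk⇔
  (λ (m , r , s) → split Y U m , subst (R a) (sym (join-split Y U m)) r , subst (λ m → S m c) (sym (join-split Y U m)) s)
  (λ (m , r , s) → join m , r , s)

⨟-injˡ : ∀ {Y W} {A B : Set} (R : REL A (El Y) 0ℓ) (S : REL B (El W) 0ℓ) a t →
         (R ⨟ Graph (injˡ W)) a (join t) ⇔ Pointwise R S (inj₁ a) t
⨟-injˡ {Y} {W} R S a (inj₁ y) = mk⇔ (λ { (m , r , eq) → case join-injective {Y} {W} {inj₁ m} {inj₁ y} eq of λ { refl → inj₁ r } }) λ { (inj₁ r) → _ , r , refl }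
⨟-injˡ {Y} {W} R S a (inj₂ w) = mk⇔ (λ { (m , r , eq) → case join-injective {Y} {W} {inj₁ m} {inj₂ w} eq of λ () }) λ ()

⨟-injʳ : ∀ {Y W} {A B : Set} (R : REL A (El Y) 0ℓ) (S : REL B (El W) 0ℓ) b t →
         (S ⨟ Graph (injʳ Y)) b (join t) ⇔ Pointwise R S (inj₂ b) t
⨟-injʳ {Y} {W} R S b (inj₂ w) = mk⇔ (λ { (m , r , eq) → case join-injective {Y} {W} {inj₂ m} {inj₂ w} eq of λ { refl → inj₂ r } }) λ { (inj₂ r) → _ , r , refl }
⨟-injʳ {Y} {W} R S b (inj₁ y) = mk⇔ (λ { (m , r , eq) → case join-injective {Y} {W} {inj₂ m} {inj₁ y} eq of λ () }) λ ()

⟦inlP⨾⟧ : ∀ {X Y Z} (h : Prog (X ++ Y) Z) → ⟦ inlP {X} {Y} ⨾ h ⟧ ≐ λ a c → ⟦ h ⟧ (injˡ Y a) c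
⟦inlP⨾⟧ {Y = Y} h = ⟦⨾⟧ inlP h ⟫ ⨟-cong ⟦inlP⟧ ≐-refl ⟫ Graph-⨟ (injˡ Y) ⟦ h ⟧

⟦inrP⨾⟧ : ∀ {X Y Z} (h : Prog (X ++ Y) Z) → ⟦ inrP {X} {Y} ⨾ h ⟧ ≐ λ b c → ⟦ h ⟧ (injʳ X b) c
⟦inrP⨾⟧ {X} h = ⟦⨾⟧ inrP h ⟫ ⨟-cong ⟦inrP⟧ ≐-refl ⟫ Graph-⨟ (injʳ X) ⟦ h ⟧

initial : ∀ {X} → Prog [] X
initial = record
  { ent = λ () ; ext = toℕ ; defs = []
  ; ent-distinct  = λ { {()} }
  ; ext-distinct  = λ eq → FinP.toℕ-injective (,-injectiveʳ eq)
  ; defs-unique   = AllPairs.[]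
  ; ext-undefined = λ _ () }

copair-unique : ∀ {X Y Z} (f : Prog X Z) (g : Prog Y Z) (h : Prog (X ++ Y) Z) →
                inlP {X} {Y} ⨾ h ≈ f → inrP {X} {Y} ⨾ h ≈ g → h ≈ copair f g
copair-unique {X} {Y} f g h hˡ hʳ = ≐⇒≈ h (copair f g) (≐-join {X} {Y} λ
  { (inj₁ a) → (≐-sym (⟦inlP⨾⟧ h) ⟫ ≈⇒≐ (inlP ⨾ h) f hˡ ⟫ ≐-sym (⟦copair⟧ˡ f g)) a
  ; (inj₂ b) → (≐-sym (⟦inrP⨾⟧ h) ⟫ ≈⇒≐ (inrP ⨾ h) g hʳ ⟫ ≐-sym (⟦copair⟧ʳ f g)) b })

coproducts : FiniteCoproducts
coproducts = record
  { ¡             = initial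
  ; ¡-unique      = λ _ ()
  ; [_,_]         = copair
  ; copair-inl    = λ f g → ≐⇒≈ (inlP ⨾ copair f g) f (⟦inlP⨾⟧ (copair f g) ⟫ ⟦copair⟧ˡ f g)
  ; copair-inr    = λ f g → ≐⇒≈ (inrP ⨾ copair f g) g (⟦inrP⨾⟧ (copair f g) ⟫ ⟦copair⟧ʳ f g)
  ; copair-unique = copair-unique
  }

open CoproductMonoidal coproducts

Graph-⨾ : ∀ {X Y Z} {P : Prog X Y} {Q : Prog Y Z} {φ ψ} → ⟦ P ⟧ ≐ Graph φ → ⟦ Q ⟧ ≐ Graph ψ →
          ⟦ P ⨾ Q ⟧ ≐ Graph (λ a → ψ (φ a))
Graph-⨾ {P = P} {Q} {φ} {ψ} P≐φ Q≐ψ = ⟦⨾⟧ P Q ⟫ ⨟-cong P≐φ Q≐ψ ⟫ Graph-⨟ φ (Graph ψ)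

⟦⨾⟧₊ : ∀ {X U Y V Z W} (P : Prog (X ++ U) (Y ++ V)) (Q : Prog (Y ++ V) (Z ++ W)) →
       ⟦_⟧₊ {X} {U} {Z} {W} (P ⨾ Q) ≐ ⟦_⟧₊ {X} {U} {Y} {V} P ⨟ ⟦_⟧₊ {Y} {V} {Z} {W} Q
⟦⨾⟧₊ P Q s t = (⟦⨾⟧ P Q ⟫ ⨟-join ⟦ P ⟧ ⟦ Q ⟧) (join s) (join t)

⟦+ₘ⟧ : ∀ {X X′ Y Y′} (f : Prog X X′) (g : Prog Y Y′) → ⟦ f +ₘ g ⟧₊ ≐ Pointwise ⟦ f ⟧ ⟦ g ⟧
⟦+ₘ⟧ {X′ = X′} {Y′ = Y′} f g (inj₁ a) t =
  ⨟-injˡ ⟦ f ⟧ ⟦ g ⟧ a t ⇔-∘ (⟦copair⟧ˡ (f ⨾ inlP) (g ⨾ inrP) ⟫ ⟦⨾⟧ f inlP ⟫ ⨟-cong ≐-refl ⟦inlP⟧) a (join t)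
⟦+ₘ⟧ {X′ = X′} {Y′ = Y′} f g (inj₂ b) t =
  ⨟-injʳ ⟦ f ⟧ ⟦ g ⟧ b t ⇔-∘ (⟦copair⟧ʳ (f ⨾ inlP) (g ⨾ inrP) ⟫ ⟦⨾⟧ g inrP ⟫ ⨟-cong ≐-refl ⟦inrP⟧) b (join t)

⟦+idP⟧ : ∀ {X X′ U} (f : Prog X X′) → ⟦ f +ₘ idP {U} ⟧₊ ≐ Pointwise ⟦ f ⟧ _≡_
⟦+idP⟧ f = ⟦+ₘ⟧ f idP ⟫ Pointwise-cong ≐-refl ⟦idP⟧

⟦idP+⟧ : ∀ {X U U′} (g : Prog U U′) → ⟦ idP {X} +ₘ g ⟧₊ ≐ Pointwise _≡_ ⟦ g ⟧
⟦idP+⟧ g = ⟦+ₘ⟧ idP g ⟫ Pointwise-cong ⟦idP⟧ ≐-refl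

-- The trace axioms

trace : ∀ {X Y U} → Prog (X ++ U) (Y ++ U) → Prog X Y
trace = Feedback.trace

⟦trace⟧ : ∀ {X Y U} (f : Prog (X ++ U) (Y ++ U)) → ⟦ trace f ⟧ ≐ Trᴿ (⟦_⟧₊ {X} {U} {Y} {U} f)
⟦trace⟧ = Feedback.⟦trace⟧

trace-cong : ∀ {X Y U} {f g : Prog (X ++ U) (Y ++ U)} → f ≈ g → trace {X} {Y} {U} f ≈ trace g
trace-cong {X} {Y} {U} {f} {g} f≈g = ≐⇒≈ (trace {X} {Y} {U} f) (trace g)
  (⟦trace⟧ {X} {Y} {U} f ⟫ Trᴿ-cong (λ s t → ≈⇒≐ f g f≈g (join s) (join t)) ⟫ ≐-sym (⟦trace⟧ {X} {Y} {U} g))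

trace-tightenˡ : ∀ {X X′ Y U} (g : Prog X′ X) (f : Prog (X ++ U) (Y ++ U)) →
                 trace {X′} {Y} {U} (f ∘ (g +ₘ idP {U})) ≈ trace f ∘ g
trace-tightenˡ {X} {X′} {Y} {U} g f = ≐⇒≈ (trace {X′} {Y} {U} ((g +ₘ idP) ⨾ f)) (g ⨾ trace {X} {Y} {U} f)
  (⟦trace⟧ {X′} {Y} {U} ((g +ₘ idP) ⨾ f)
   ⟫ Trᴿ-cong (⟦⨾⟧₊ (g +ₘ idP) f ⟫ ⨟-cong (⟦+idP⟧ g) ≐-refl)
   ⟫ Trᴿ-tightenˡ ⟦ g ⟧ ⟦ f ⟧₊
   ⟫ ⨟-cong ≐-refl (≐-sym (⟦trace⟧ {X} {Y} {U} f))
   ⟫ ≐-sym (⟦⨾⟧ g (trace {X} {Y} {U} f)))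

trace-tightenʳ : ∀ {X Y Y′ U} (f : Prog (X ++ U) (Y ++ U)) (h : Prog Y Y′) →
                 trace {X} {Y′} {U} ((h +ₘ idP {U}) ∘ f) ≈ h ∘ trace f
trace-tightenʳ {X} {Y} {Y′} {U} f h = ≐⇒≈ (trace {X} {Y′} {U} (f ⨾ (h +ₘ idP))) (trace {X} {Y} {U} f ⨾ h)
  (⟦trace⟧ {X} {Y′} {U} (f ⨾ (h +ₘ idP))
   ⟫ Trᴿ-cong (⟦⨾⟧₊ f (h +ₘ idP) ⟫ ⨟-cong ≐-refl (⟦+idP⟧ h))
   ⟫ Trᴿ-tightenʳ ⟦ f ⟧₊ ⟦ h ⟧
   ⟫ ⨟-cong (≐-sym (⟦trace⟧ {X} {Y} {U} f)) ≐-refl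
   ⟫ ≐-sym (⟦⨾⟧ (trace {X} {Y} {U} f) h))

trace-slide : ∀ {X Y U U′} (f : Prog (X ++ U) (Y ++ U′)) (g : Prog U′ U) →
              trace {X} {Y} {U} ((idP {Y} +ₘ g) ∘ f) ≈ trace {X} {Y} {U′} (f ∘ (idP {X} +ₘ g))
trace-slide {X} {Y} {U} {U′} f g = ≐⇒≈ (trace {X} {Y} {U} (f ⨾ (idP +ₘ g))) (trace {X} {Y} {U′} ((idP +ₘ g) ⨾ f))
  (⟦trace⟧ {X} {Y} {U} (f ⨾ (idP +ₘ g))
   ⟫ Trᴿ-cong (⟦⨾⟧₊ f (idP +ₘ g) ⟫ ⨟-cong ≐-refl (⟦idP+⟧ g))
   ⟫ Trᴿ-slide ⟦ f ⟧₊ ⟦ g ⟧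
   ⟫ ≐-sym (Trᴿ-cong (⟦⨾⟧₊ (idP +ₘ g) f ⟫ ⨟-cong (⟦idP+⟧ g) ≐-refl))
   ⟫ ≐-sym (⟦trace⟧ {X} {Y} {U′} ((idP +ₘ g) ⨾ f)))

⨟-runit : ∀ {Y} {A : Set} (R : REL A (El (Y ++ [])) 0ℓ) → R ⨟ ⟦ runit {Y} ⟧ ≐ λ a b → R a (injˡ [] b)
⨟-runit {Y} R = ⨟-join R ⟦ runit ⟧ ⟫ λ a b → mk⇔
  (λ { (inj₁ y , r , t) → subst (λ y → R a (injˡ [] y)) (to (⟦idP⟧ y b ⇔-∘ ⟦copair⟧ˡ idP initial y b) t) r
     ; (inj₂ (() ▸ _) , _) })
  (λ r → inj₁ b , r , from (⟦idP⟧ b b ⇔-∘ ⟦copair⟧ˡ idP initial b b) refl)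

trace-vanish[] : ∀ {X Y} (f : Prog (X ++ []) (Y ++ [])) → trace {X} {Y} {[]} f ≈ runit ∘ f ∘ runit⁻¹
trace-vanish[] {X} {Y} f = ≐⇒≈ (trace {X} {Y} {[]} f) ((inlP ⨾ f) ⨾ runit)
  (⟦trace⟧ {X} {Y} {[]} f
   ⟫ Trᴿ-vanish ⟦ f ⟧₊ (λ { (() ▸ _) })
   ⟫ (λ a b → ⇔-sym (⟦inlP⨾⟧ f a (injˡ [] b)))
   ⟫ ≐-sym (⟦⨾⟧ (inlP ⨾ f) runit ⟫ ⨟-runit ⟦ inlP ⨾ f ⟧))

⟦swap⟧ : ∀ {U} → ⟦_⟧₊ {U} {U} {U} {U} (swap {U} {U}) ≐ λ s t → ⊎-swap s ≡ t
⟦swap⟧ {U} (inj₁ a) t = join≡join⇔≡ (inj₂ a) t ⇔-∘ (⟦copair⟧ˡ (inrP {U} {U}) (inlP {U} {U}) ⟫ ⟦inrP⟧) a (join t)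
⟦swap⟧ {U} (inj₂ b) t = join≡join⇔≡ (inj₁ b) t ⇔-∘ (⟦copair⟧ʳ (inrP {U} {U}) (inlP {U} {U}) ⟫ ⟦inlP⟧) b (join t)

trace-yank : ∀ {U} → trace {U} {U} {U} (swap {U} {U}) ≈ idP
trace-yank {U} = ≐⇒≈ (trace {U} {U} {U} (swap {U} {U})) idP
  (⟦trace⟧ {U} {U} {U} (swap {U} {U}) ⟫ Trᴿ-cong ⟦swap⟧ ⟫ Trᴿ-yank ⟫ ≐-sym ⟦idP⟧)

trace-uniform : ∀ {X Y U U′} (f : Prog (X ++ U) (Y ++ U)) (g : Prog (X ++ U′) (Y ++ U′)) (h : Prog U U′) →
                (idP {Y} +ₘ h) ∘ f ≈ g ∘ (idP {X} +ₘ h) → trace {X} {Y} {U} f ≈ trace {X} {Y} {U′} g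
trace-uniform {X} {Y} {U} {U′} f g h hf≈gh = ≐⇒≈ (trace {X} {Y} {U} f) (trace {X} {Y} {U′} g)
  (⟦trace⟧ {X} {Y} {U} f ⟫ Trᴿ-uniform ⟦ f ⟧₊ ⟦ g ⟧₊ ⟦ h ⟧ f⨟h≐h⨟g ⟫ ≐-sym (⟦trace⟧ {X} {Y} {U′} g))
  where
  f⨟h≐h⨟g : ⟦ f ⟧₊ ⨟ Pointwise _≡_ ⟦ h ⟧ ≐ Pointwise _≡_ ⟦ h ⟧ ⨟ ⟦ g ⟧₊
  f⨟h≐h⨟g = ≐-sym (⟦⨾⟧₊ f (idP +ₘ h) ⟫ ⨟-cong ≐-refl (⟦idP+⟧ h))
          ⟫ (λ s t → ≈⇒≐ (f ⨾ (idP +ₘ h)) ((idP +ₘ h) ⨾ g) hf≈gh (join s) (join t))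
          ⟫ ⟦⨾⟧₊ (idP +ₘ h) g ⟫ ⨟-cong (⟦idP+⟧ h) ≐-refl

join₃ʳ : ∀ {X Y Z} → El X ⊎ (El Y ⊎ El Z) → El (X ++ (Y ++ Z))
join₃ʳ s = join (map₂ join s)

join₃ˡ : ∀ {X Y Z} → (El X ⊎ El Y) ⊎ El Z → El ((X ++ Y) ++ Z)
join₃ˡ x = join (map₁ join x)

join₃ʳ-surjective : ∀ X Y Z (e : El (X ++ (Y ++ Z))) → ∃ λ s → join₃ʳ {X} {Y} {Z} s ≡ e
join₃ʳ-surjective X Y Z e with split X (Y ++ Z) e | join-split X (Y ++ Z) e
... | inj₁ a | eq = inj₁ a , eq
... | inj₂ m | eq = inj₂ (split Y Z m) , trans (cong (λ m → join {X} (inj₂ m)) (join-split Y Z m)) eq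

join₃ˡ-injective : ∀ {X Y Z} {x x′ : (El X ⊎ El Y) ⊎ El Z} → join₃ˡ x ≡ join₃ˡ x′ → x ≡ x′
join₃ˡ-injective {X} {Y} {Z} {x} {x′} eq = map₁-join-injective x x′ (join-injective {X ++ Y} {Z} eq)
  where
  map₁-join-injective : ∀ x x′ → map₁ join x ≡ map₁ join x′ → x ≡ x′
  map₁-join-injective (inj₁ p) (inj₁ p′) e = cong inj₁ (join-injective {X} {Y} (inj₁-injective e))
  map₁-join-injective (inj₂ c) (inj₂ c′) e = cong inj₂ (inj₂-injective e)

assocʳ-assocˡ : ∀ {A B C : Set} (s : A ⊎ (B ⊎ C)) → assocʳ (assocˡ s) ≡ s
assocʳ-assocˡ (inj₁ _)        = refl
assocʳ-assocˡ (inj₂ (inj₁ _)) = refl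
assocʳ-assocˡ (inj₂ (inj₂ _)) = refl

assocˡ-assocʳ : ∀ {A B C : Set} (x : (A ⊎ B) ⊎ C) → assocˡ (assocʳ x) ≡ x
assocˡ-assocʳ (inj₁ (inj₁ _)) = refl
assocˡ-assocʳ (inj₁ (inj₂ _)) = refl
assocˡ-assocʳ (inj₂ _)        = refl


module _ {X Y Z : List Ty₀} where
  private
    inlX = inlP {X} {Y ++ Z}
    inrX = inrP {X} {Y ++ Z}
    inlXY = inlP {X ++ Y} {Z}
    inrXY = inrP {X ++ Y} {Z}

  ⟦assoc⟧ : ∀ s e → ⟦ assoc {X} {Y} {Z} ⟧ (join₃ʳ s) e ⇔ join₃ˡ (assocˡ s) ≡ e
  ⟦assoc⟧ (inj₁ a) e =
    (⟦copair⟧ˡ (inlP ⨾ inlXY) (copair (inrP ⨾ inlXY) inrXY)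
     ⟫ Graph-⨾ {P = inlP {X} {Y}} {Q = inlXY} (⟦inlP⟧ {X} {Y}) (⟦inlP⟧ {X ++ Y} {Z})) a e
  ⟦assoc⟧ (inj₂ (inj₁ b)) e =
    (⟦copair⟧ˡ (inrP ⨾ inlXY) inrXY ⟫ Graph-⨾ {P = inrP {X} {Y}} {Q = inlXY} (⟦inrP⟧ {X} {Y}) (⟦inlP⟧ {X ++ Y} {Z})) b e
    ⇔-∘ ⟦copair⟧ʳ (inlP ⨾ inlXY) (copair (inrP ⨾ inlXY) inrXY) (injˡ Z b) e
  ⟦assoc⟧ (inj₂ (inj₂ c)) e =
    (⟦copair⟧ʳ (inrP {X} {Y} ⨾ inlXY) inrXY ⟫ ⟦inrP⟧ {X ++ Y} {Z}) c e
    ⇔-∘ ⟦copair⟧ʳ (inlP ⨾ inlXY) (copair (inrP ⨾ inlXY) inrXY) (injʳ Y c) e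

  ⟦assoc⁻¹⟧ : ∀ x e → ⟦ assoc⁻¹ {X} {Y} {Z} ⟧ (join₃ˡ x) e ⇔ join₃ʳ (assocʳ x) ≡ e
  ⟦assoc⁻¹⟧ (inj₁ (inj₁ a)) e =
    (⟦copair⟧ˡ inlX (inlP {Y} {Z} ⨾ inrX) ⟫ ⟦inlP⟧ {X} {Y ++ Z}) a e
    ⇔-∘ ⟦copair⟧ˡ (copair inlX (inlP ⨾ inrX)) (inrP {Y} {Z} ⨾ inrX) (injˡ Y a) e
  ⟦assoc⁻¹⟧ (inj₁ (inj₂ b)) e =
    (⟦copair⟧ʳ inlX (inlP ⨾ inrX) ⟫ Graph-⨾ {P = inlP {Y} {Z}} {Q = inrX} (⟦inlP⟧ {Y} {Z}) (⟦inrP⟧ {X} {Y ++ Z})) b e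
    ⇔-∘ ⟦copair⟧ˡ (copair inlX (inlP ⨾ inrX)) (inrP {Y} {Z} ⨾ inrX) (injʳ X b) e
  ⟦assoc⁻¹⟧ (inj₂ c) e =
    (⟦copair⟧ʳ (copair inlX (inlP {Y} {Z} ⨾ inrX)) (inrP {Y} {Z} ⨾ inrX) ⟫ Graph-⨾ {P = inrP {Y} {Z}} {Q = inrX} (⟦inrP⟧ {Y} {Z}) (⟦inrP⟧ {X} {Y ++ Z})) c e

⟦assoc∘_∘assoc⁻¹⟧ : ∀ {A B C D E F} (N : Prog (A ++ (B ++ C)) (D ++ (E ++ F))) x y →
  ⟦ assoc {D} {E} {F} ∘ N ∘ assoc⁻¹ {A} {B} {C} ⟧ (join₃ˡ x) (join₃ˡ y) ⇔ ⟦ N ⟧ (join₃ʳ (assocʳ x)) (join₃ʳ (assocʳ y))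
⟦assoc∘_∘assoc⁻¹⟧ {A} {B} {C} {D} {E} {F} N x y = mk⇔ ⇒ ⇐
  where
  α⁻¹ = assoc⁻¹ {A} {B} {C}
  α = assoc {D} {E} {F}

  unassoc : ∀ {m m′} → ⟦ α⁻¹ ⟧ (join₃ˡ x) m → ⟦ N ⟧ m m′ → ⟦ α ⟧ m′ (join₃ˡ y) →
            ⟦ N ⟧ (join₃ʳ (assocʳ x)) (join₃ʳ (assocʳ y))
  unassoc {m} {m′} t₁ t₂ t₃ with join₃ʳ-surjective D E F m′
  ... | s′ , refl = subst₂ ⟦ N ⟧ (sym (to (⟦assoc⁻¹⟧ {A} {B} {C} x m) t₁))
                      (cong join₃ʳ (trans (sym (assocʳ-assocˡ s′))
                        (cong assocʳ (join₃ˡ-injective {D} {E} {F} {assocˡ s′} {y} (to (⟦assoc⟧ {D} {E} {F} s′ (join₃ˡ y)) t₃)))))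
                      t₂

  ⇒ : ⟦ (α⁻¹ ⨾ N) ⨾ α ⟧ (join₃ˡ x) (join₃ˡ y) → ⟦ N ⟧ (join₃ʳ (assocʳ x)) (join₃ʳ (assocʳ y))
  ⇒ t = case to (⟦⨾⟧ (α⁻¹ ⨾ N) α _ _) t of λ
    { (_ , t₁₂ , t₃) → case to (⟦⨾⟧ α⁻¹ N _ _) t₁₂ of λ { (_ , t₁ , t₂) → unassoc t₁ t₂ t₃ } }

  ⇐ : ⟦ N ⟧ (join₃ʳ (assocʳ x)) (join₃ʳ (assocʳ y)) → ⟦ (α⁻¹ ⨾ N) ⨾ α ⟧ (join₃ˡ x) (join₃ˡ y)
  ⇐ t = from (⟦⨾⟧ (α⁻¹ ⨾ N) α _ _)
          (_ , from (⟦⨾⟧ α⁻¹ N _ _) (_ , from (⟦assoc⁻¹⟧ {A} {B} {C} x _) refl , t) ,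
           from (⟦assoc⟧ {D} {E} {F} (assocʳ y) _) (cong join₃ˡ (assocˡ-assocʳ y)))

trace-vanish++ : ∀ {X Y U V} (f : Prog (X ++ (U ++ V)) (Y ++ (U ++ V))) →
  trace {X} {Y} {U ++ V} f
    ≈ trace {X} {Y} {U} (trace {X ++ U} {Y ++ U} {V} (assoc {Y} {U} {V} ∘ f ∘ assoc⁻¹ {X} {U} {V}))
trace-vanish++ {X} {Y} {U} {V} f = ≐⇒≈ (trace {X} {Y} {U ++ V} f) (trace {X} {Y} {U} (trace {X ++ U} {Y ++ U} {V} M))
  (⟦trace⟧ {X} {Y} {U ++ V} f
   ⟫ Trᴿ-reindex-loop join (λ e → split U V e , join-split U V e) ⟦ f ⟧₊
   ⟫ Trᴿ-vanish⊎ (λ s t → ⟦ f ⟧ (join₃ʳ s) (join₃ʳ t))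
   ⟫ Trᴿ-cong (Trᴿ-cong (λ x y → ⇔-sym (⟦assoc∘ f ∘assoc⁻¹⟧ x y)))
   ⟫ Trᴿ-cong (λ s t → ⇔-sym (Trᴿ-reindex join join ⟦ M ⟧₊ s t ⇔-∘ ⟦trace⟧ {X ++ U} {Y ++ U} {V} M (join s) (join t)))
   ⟫ ≐-sym (⟦trace⟧ {X} {Y} {U} (trace {X ++ U} {Y ++ U} {V} M)))
  where
  M = assoc {Y} {U} {V} ∘ f ∘ assoc⁻¹ {X} {U} {V}

Pointwise-map₂ : ∀ {A B C D C′ D′ : Set} {R : REL A B 0ℓ} {S : REL C D 0ℓ} (φ : C′ → C) (ψ : D′ → D) p q →
                 Pointwise R S (map₂ φ p) (map₂ ψ q) ⇔ Pointwise R (λ c d → S (φ c) (ψ d)) p q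
Pointwise-map₂ φ ψ (inj₁ _) (inj₁ _) = mk⇔ (λ { (inj₁ r) → inj₁ r }) (λ { (inj₁ r) → inj₁ r })
Pointwise-map₂ φ ψ (inj₁ _) (inj₂ _) = mk⇔ (λ ()) (λ ())
Pointwise-map₂ φ ψ (inj₂ _) (inj₁ _) = mk⇔ (λ ()) (λ ())
Pointwise-map₂ φ ψ (inj₂ _) (inj₂ _) = mk⇔ (λ { (inj₂ r) → inj₂ r }) (λ { (inj₂ r) → inj₂ r })

trace-superpose : ∀ {W Z X Y U} (g : Prog W Z) (f : Prog (X ++ U) (Y ++ U)) →
  trace {W ++ X} {Z ++ Y} {U} (assoc {Z} {Y} {U} ∘ (g +ₘ f) ∘ assoc⁻¹ {W} {X} {U}) ≈ g +ₘ trace {X} {Y} {U} f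
trace-superpose {W} {Z} {X} {Y} {U} g f = ≐⇒≈ (trace {W ++ X} {Z ++ Y} {U} M) (g +ₘ trace {X} {Y} {U} f) (≐-join₂ {W} {Z} {X} {Y}
  ((λ s t → ⟦trace⟧ {W ++ X} {Z ++ Y} {U} M (join s) (join t))
  ⟫ (λ s t → Trᴿ-reindex join join (⟦_⟧₊ {W ++ X} {U} {Z ++ Y} {U} M) s t)
  ⟫ Trᴿ-cong (λ x y → Pointwise-map₂ join join (assocʳ x) (assocʳ y)
                      ⇔-∘ (⟦+ₘ⟧ g f (map₂ join (assocʳ x)) (map₂ join (assocʳ y))
                      ⇔-∘ ⟦assoc∘ g +ₘ f ∘assoc⁻¹⟧ x y))
  ⟫ Trᴿ-superpose ⟦ g ⟧ (⟦_⟧₊ {X} {U} {Y} {U} f)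
  ⟫ Pointwise-cong ≐-refl (≐-sym (⟦trace⟧ {X} {Y} {U} f))
  ⟫ ≐-sym (⟦+ₘ⟧ g (trace {X} {Y} {U} f))))
  where
  M = assoc {Z} {Y} {U} ∘ (g +ₘ f) ∘ assoc⁻¹ {W} {X} {U}

uniformTrace : UniformTrace coproducts
uniformTrace = record
  { Tr               = λ {X} {Y} {U} → trace {X} {Y} {U}
  ; Tr-cong          = λ {X} {Y} {U} {f} {g} → trace-cong {X} {Y} {U} {f} {g}
  ; tightening-left  = trace-tightenˡ
  ; tightening-right = trace-tightenʳ
  ; sliding          = trace-slide
  ; vanishing-unit   = trace-vanish[]
  ; vanishing-tensor = trace-vanish++
  ; superposing      = trace-superpose
  ; yanking          = trace-yank
  ; uniformity       = trace-uniform
  }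

lemma2p6 : Σ FiniteCoproducts UniformTrace
lemma2p6 = coproducts , uniformTrace
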